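{- Let $n=p_1p_2p_3p_4$, where $p_1,\dots,p_4$ are distinct primes. Then the adjacency spectrum of the essential ideal graph $\mathcal{E}_{\mathbb{Z}_n}$ consists of: $\frac{5+\sqrt{21}}{2}$ with multiplicity $1$; $1$ with multiplicity $5$; $\frac{5-\sqrt{21}}{2}$ with multiplicity $1$; $\frac{ -3+\sqrt5}{2}$ with multiplicity $3$; $-1$ with multiplicity $1$; and $\frac{ -3-\sqrt5}{2}$ with multiplicity $3$.
   Context: $\mathbb{Z}_n$ is the ring of integers modulo $n$. An ideal $I$ of a commutative ring $R$ is essential if $I\cap J\neq\{0\}$ for every nonzero ideal $J$ of $R$. The essential ideal graph $\mathcal{E}_{\mathbb{Z}_n}$ is the simple graph whose vertex set is the set of all nonzero proper ideals of $\mathbb{Z}_n$, two distinct vertices $I,K$ being adjacent if and only if $I+K$ is an essential ideal of $\mathbb{Z}_n$. The (adjacency) spectrum of a graph is the multiset of eigenvalues of its adjacency matrix. -}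

module Defs where

open import Data.Nat as ℕ using (ℕ; zero; suc; NonZero)
open import Data.Nat.DivMod using (_%_; m%n<n)
open import Data.Fin as Fin using (Fin; toℕ; fromℕ<; punchIn)
open import Data.Fin.Subset using (Subset; _∈_; _∉_)
open import Data.Integer as ℤ using (ℤ)
open import Data.Product using (Σ; ∃; ∃-syntax; _×_)
open import Data.Sum using (_⊎_)
open import Data.Bool using (if_then_else_)
open import Relation.Nullary using (¬_; does)
open import Relation.Binary.PropositionalEquality using (_≡_; _≢_)
open import Function.Bundles using (_↔_; Inverse)

module _ {n : ℕ} .{{_ : NonZero n}} where

  0ₙ : Fin n
  0ₙ = fromℕ< (m%n<n 0 n)

  _+ₙ_ : Fin n → Fin n → Fin n
  a +ₙ b = fromℕ< (m%n<n (toℕ a ℕ.+ toℕ b) n)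

  _*ₙ_ : Fin n → Fin n → Fin n
  a *ₙ b = fromℕ< (m%n<n (toℕ a ℕ.* toℕ b) n)

  -ₙ_ : Fin n → Fin n
  -ₙ a = fromℕ< (m%n<n (n ℕ.∸ toℕ a) n)

-- Ideals of ℤ_n: subsets (given as Subset n) that are additive
-- subgroups closed under multiplication by ring elements.
-- Proof fields are irrelevant, so an ideal is determined by its carrier.

record Ideal (n : ℕ) .{{_ : NonZero n}} : Set where
  constructor mkIdeal
  field
    carrier  : Subset n
    .zero∈   : 0ₙ ∈ carrier
    .+-closed : ∀ a b → a ∈ carrier → b ∈ carrier → (a +ₙ b) ∈ carrier
    .neg-closed : ∀ a → a ∈ carrier → (-ₙ a) ∈ carrier
    .mul-closed : ∀ r a → a ∈ carrier → (r *ₙ a) ∈ carrier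
open Ideal public

module _ {n : ℕ} .{{_ : NonZero n}} where

  NonzeroIdeal : Ideal n → Set
  NonzeroIdeal I = ∃[ x ] (x ∈ carrier I × x ≢ 0ₙ)

  ProperIdeal : Ideal n → Set
  ProperIdeal I = ∃[ x ] (x ∉ carrier I)

  _∈Sum[_,_] : Fin n → Ideal n → Ideal n → Set
  x ∈Sum[ I , K ] = ∃[ a ] ∃[ b ] (a ∈ carrier I × b ∈ carrier K × x ≡ a +ₙ b)

  Essential : (Fin n → Set) → Set
  Essential P = ∀ (J : Ideal n) → NonzeroIdeal J →
                ∃[ x ] (P x × x ∈ carrier J × x ≢ 0ₙ)

record Vertex (n : ℕ) .{{_ : NonZero n}} : Set where
  constructor mkVertex
  field
    ideal    : Ideal n
    .nonzero : NonzeroIdeal ideal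
    .proper  : ProperIdeal ideal
open Vertex public

module _ {n : ℕ} .{{_ : NonZero n}} where

  EAdj : Vertex n → Vertex n → Set
  EAdj v w = v ≢ w × Essential (λ x → x ∈Sum[ ideal v , ideal w ])

  IsAdjMatrix : ∀ {k} → (e : Fin k ↔ Vertex n) → (Fin k → Fin k → ℤ) → Set
  IsAdjMatrix e M = ∀ i j →
      (EAdj (Inverse.to e i) (Inverse.to e j) × M i j ≡ ℤ.1ℤ)
    ⊎ (¬ EAdj (Inverse.to e i) (Inverse.to e j) × M i j ≡ ℤ.0ℤ)

sumFin : ∀ {k} → (Fin k → ℤ) → ℤ
sumFin {zero}  f = ℤ.0ℤ
sumFin {suc k} f = f Fin.zero ℤ.+ sumFin (λ i → f (Fin.suc i))

sign : ℕ → ℤ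
sign zero          = ℤ.1ℤ
sign (suc zero)    = ℤ.-1ℤ
sign (suc (suc m)) = sign m

det : ∀ {k} → (Fin k → Fin k → ℤ) → ℤ
det {zero}  M = ℤ.1ℤ
det {suc k} M = sumFin (λ j →
  sign (toℕ j) ℤ.* (M Fin.zero j ℤ.* det (λ i l → M (Fin.suc i) (punchIn j l))))

charPolyAt : ∀ {k} → (Fin k → Fin k → ℤ) → ℤ → ℤ
charPolyAt M x = det (λ i j → (if does (i Fin.≟ j) then x else ℤ.0ℤ) ℤ.- M i j)

-- (x² − 5x + 1)(x − 1)^5 (x² + 3x + 1)^3 (x + 1): the monic polynomial whose
-- roots with multiplicity are (5±√21)/2 (×1), 1 (×5), (−3±√5)/2 (×3), −1 (×1).
targetPoly : ℤ → ℤ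
targetPoly x =
  (x ℤ.* x ℤ.- ℤ.+ 5 ℤ.* x ℤ.+ ℤ.1ℤ)
  ℤ.* ((x ℤ.- ℤ.1ℤ) ℤ.^ 5)
  ℤ.* ((x ℤ.* x ℤ.+ ℤ.+ 3 ℤ.* x ℤ.+ ℤ.1ℤ) ℤ.^ 3)
  ℤ.* (x ℤ.+ ℤ.1ℤ)

{-# OPTIONS --safe #-}
module Submission where

-- Every ideal of ℤₙ is the set of multiples of a divisor of n: of the gcd of its elements, which
-- lies in the ideal by Bézout. For n = p₁p₂p₃p₄ the divisors are the products ∏ S over the subsets S
-- of the four primes, and the nonzero proper ideals are the 14 with ∅ ≠ S ≠ {p₁,p₂,p₃,p₄}. The
-- minimal ideals of ℤₙ are the (n / pᵢ)ℤₙ, and a multiple of pᵢ meets (n / pᵢ)ℤₙ only in 0; hence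
-- (∏ S)ℤₙ + (∏ T)ℤₙ is essential exactly when S and T are disjoint. The graph is therefore the
-- disjointness graph of the 14 subsets. Its characteristic polynomial is computed symbolically for
-- one enumeration of the vertices, and it is the same for every enumeration because the determinant
-- is invariant under a simultaneous permutation of rows and columns.

open import Defs

module Determinant where

  open import Data.Nat using (ℕ; zero; suc)
  open import Data.Integer using (ℤ; _+_; _-_; _*_; -_; 0ℤ; 1ℤ)
  open import Data.Integer.Properties
    using (+-identityˡ; *-zeroʳ; *-distribˡ-+; neg-distrib-+; neg-distribˡ-*; neg-involutive)
  open import Data.Integer.Tactic.RingSolver using (solve-∀)
  open import Data.Fin using (Fin; zero; suc; toℕ; inject₁; punchIn; punchOut; lift; _≟_)
  open import Data.Fin.Properties
    using ( toℕ-inject₁; suc-injective; punchInᵢ≢i; punchOut-cong; punchOut-punchIn; punchIn-punchOut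
          ; punchOut-injective)
  open import Data.Bool using (if_then_else_)
  open import Data.Product using (Σ; _,_)
  open import Data.Empty using (⊥-elim)
  open import Function using (_∘_)
  open import Function.Definitions using (Injective)
  open import Relation.Nullary using (does; yes; no)
  open import Relation.Binary.PropositionalEquality

  Matrix : ℕ → Set
  Matrix k = Fin k → Fin k → ℤ

  sumFin-cong : ∀ {k} {f g : Fin k → ℤ} → (∀ i → f i ≡ g i) → sumFin f ≡ sumFin g
  sumFin-cong {zero}  f≗g = refl
  sumFin-cong {suc k} f≗g = cong₂ _+_ (f≗g zero) (sumFin-cong (f≗g ∘ suc))

  sumFin-zero : ∀ {k} → sumFin {k} (λ _ → 0ℤ) ≡ 0ℤ
  sumFin-zero {zero}  = refl
  sumFin-zero {suc k} = trans (+-identityˡ _) (sumFin-zero {k})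

  sumFin-+ : ∀ {k} (f g : Fin k → ℤ) → sumFin (λ i → f i + g i) ≡ sumFin f + sumFin g
  sumFin-+ {zero}  f g = refl
  sumFin-+ {suc k} f g rewrite sumFin-+ (f ∘ suc) (g ∘ suc) =
    interchange (f zero) (g zero) (sumFin (f ∘ suc)) (sumFin (g ∘ suc))
    where
    interchange : ∀ a b c d → a + b + (c + d) ≡ a + c + (b + d)
    interchange = solve-∀

  sumFin-neg : ∀ {k} (f : Fin k → ℤ) → sumFin (λ i → - f i) ≡ - sumFin f
  sumFin-neg {zero}  f = refl
  sumFin-neg {suc k} f = trans (cong (- f zero +_) (sumFin-neg (f ∘ suc)))
                               (sym (neg-distrib-+ (f zero) (sumFin (f ∘ suc))))

  *-sumFin : ∀ {k} c (f : Fin k → ℤ) → c * sumFin f ≡ sumFin (λ i → c * f i)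
  *-sumFin {zero}  c f = *-zeroʳ c
  *-sumFin {suc k} c f = trans (*-distribˡ-+ c (f zero) _) (cong (c * f zero +_) (*-sumFin c (f ∘ suc)))

  sumFin-comm : ∀ {k m} (F : Fin k → Fin m → ℤ) →
    sumFin (λ a → sumFin (F a)) ≡ sumFin (λ b → sumFin (λ a → F a b))
  sumFin-comm {zero}  {m} F = sym (sumFin-zero {m})
  sumFin-comm {suc k} {m} F = trans (cong (sumFin (F zero) +_) (sumFin-comm (F ∘ suc)))
                                    (sym (sumFin-+ (F zero) _))

  sumFin-punchIn : ∀ {k} (a : Fin (suc k)) (f : Fin (suc k) → ℤ) →
    sumFin f ≡ f a + sumFin (f ∘ punchIn a)
  sumFin-punchIn zero          f = refl
  sumFin-punchIn {suc k} (suc a) f rewrite sumFin-punchIn a (f ∘ suc) =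
    exchange (f zero) (f (suc a)) (sumFin (f ∘ suc ∘ punchIn a))
    where
    exchange : ∀ x y z → x + (y + z) ≡ y + (x + z)
    exchange = solve-∀

  det-cong : ∀ {k} {A B : Matrix k} → (∀ i j → A i j ≡ B i j) → det A ≡ det B
  det-cong {zero}  A≗B = refl
  det-cong {suc k} A≗B = sumFin-cong λ j →
    cong₂ (λ a d → sign (toℕ j) * (a * d)) (A≗B zero j) (det-cong λ i l → A≗B (suc i) (punchIn j l))

  sign-suc : ∀ m → sign (suc m) ≡ - sign m
  sign-suc zero    = refl
  sign-suc (suc m) = trans (sym (neg-involutive (sign m))) (cong -_ (sym (sign-suc m)))

  minor : ∀ {k} → Fin (suc k) → Matrix (suc k) → Matrix k
  minor j A i l = A (suc i) (punchIn j l)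

  laplaceTerm : ∀ {k} → Matrix (suc k) → Fin (suc k) → ℤ
  laplaceTerm A j = sign (toℕ j) * (A zero j * det (minor j A))

  swap : ∀ {k} → Fin k → Fin (suc k) → Fin (suc k)
  swap zero    zero          = suc zero
  swap zero    (suc zero)    = zero
  swap zero    (suc (suc j)) = suc (suc j)
  swap (suc c) zero          = zero
  swap (suc c) (suc j)       = suc (swap c j)

  swap-inject₁ : ∀ {k} (c : Fin k) → swap c (inject₁ c) ≡ suc c
  swap-inject₁ zero    = refl
  swap-inject₁ (suc c) = cong suc (swap-inject₁ c)

  swap-suc : ∀ {k} (c : Fin k) → swap c (suc c) ≡ inject₁ c
  swap-suc zero    = refl
  swap-suc (suc c) = cong suc (swap-suc c)

  swap-fix : ∀ {k} (c : Fin k) j → j ≢ inject₁ c → j ≢ suc c → swap c j ≡ j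
  swap-fix zero    zero          j≢c _     = ⊥-elim (j≢c refl)
  swap-fix zero    (suc zero)    _   j≢c+1 = ⊥-elim (j≢c+1 refl)
  swap-fix zero    (suc (suc j)) _   _     = refl
  swap-fix (suc c) zero          _   _     = refl
  swap-fix (suc c) (suc j)       j≢c j≢c+1 = cong suc (swap-fix c j (j≢c ∘ cong suc) (j≢c+1 ∘ cong suc))

  swap-punchIn-inject₁ : ∀ {k} (c : Fin k) l → swap c (punchIn (inject₁ c) l) ≡ punchIn (suc c) l
  swap-punchIn-inject₁ zero    zero    = refl
  swap-punchIn-inject₁ zero    (suc l) = refl
  swap-punchIn-inject₁ (suc c) zero    = refl
  swap-punchIn-inject₁ (suc c) (suc l) = cong suc (swap-punchIn-inject₁ c l)

  swap-punchIn-suc : ∀ {k} (c : Fin k) l → swap c (punchIn (suc c) l) ≡ punchIn (inject₁ c) l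
  swap-punchIn-suc zero    zero    = refl
  swap-punchIn-suc zero    (suc l) = refl
  swap-punchIn-suc (suc c) zero    = refl
  swap-punchIn-suc (suc c) (suc l) = cong suc (swap-punchIn-suc c l)

  swap-punchIn : ∀ {k} (c : Fin (suc k)) j → j ≢ inject₁ c → j ≢ suc c →
    Σ (Fin k) λ c′ → ∀ l → swap c (punchIn j l) ≡ punchIn j (swap c′ l)
  swap-punchIn         zero    zero          j≢c _     = ⊥-elim (j≢c refl)
  swap-punchIn         zero    (suc zero)    _   j≢c+1 = ⊥-elim (j≢c+1 refl)
  swap-punchIn {suc k} zero    (suc (suc j)) _   _     =
    zero , λ { zero → refl ; (suc zero) → refl ; (suc (suc l)) → refl }
  swap-punchIn {suc k} (suc c) zero          _   _     = c , λ l → refl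
  swap-punchIn {suc k} (suc c) (suc j)       j≢c j≢c+1
    with c′ , eq ← swap-punchIn c j (j≢c ∘ cong suc) (j≢c+1 ∘ cong suc) =
    suc c′ , λ { zero → refl ; (suc l) → cong suc (eq l) }

  sumFin-swap : ∀ {k} (c : Fin k) (f : Fin (suc k) → ℤ) → sumFin (f ∘ swap c) ≡ sumFin f
  sumFin-swap {suc k} zero    f = exchange (f (suc zero)) (f zero) (sumFin (λ i → f (suc (suc i))))
    where
    exchange : ∀ x y z → x + (y + z) ≡ y + (x + z)
    exchange = solve-∀
  sumFin-swap {suc k} (suc c) f = cong (f zero +_) (sumFin-swap c (f ∘ suc))

  sign-swap : ∀ {k} (c : Fin k) → sign (toℕ (suc c)) ≡ - sign (toℕ (inject₁ c))
  sign-swap c rewrite toℕ-inject₁ c = sign-suc (toℕ c)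

  det-swapColumns : ∀ {k} (c : Fin k) (A : Matrix (suc k)) → det (λ i j → A i (swap c j)) ≡ - det A
  det-swapColumns {suc k} c A = begin
    sumFin (laplaceTerm A′)                   ≡⟨ sumFin-cong term-swap ⟩
    sumFin (λ j → - laplaceTerm A (swap c j)) ≡⟨ sumFin-neg (laplaceTerm A ∘ swap c) ⟩
    - sumFin (laplaceTerm A ∘ swap c)         ≡⟨ cong -_ (sumFin-swap c (laplaceTerm A)) ⟩
    - det A                                   ∎
    where
    open ≡-Reasoning
    A′ : Matrix (suc (suc k))
    A′ i j = A i (swap c j)
    negate : ∀ s a d → s * (a * d) ≡ - (- s * (a * d))
    negate = solve-∀
    negate′ : ∀ s a d → - s * (a * d) ≡ - (s * (a * d))
    negate′ = solve-∀
    negate″ : ∀ s a d → s * (a * - d) ≡ - (s * (a * d))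
    negate″ = solve-∀
    term-swap : ∀ j → laplaceTerm A′ j ≡ - laplaceTerm A (swap c j)
    term-swap j with j ≟ inject₁ c | j ≟ suc c
    ... | yes refl | _ rewrite swap-inject₁ c | sign-swap c
          | det-cong {B = minor (suc c) A} (λ i l → cong (A (suc i)) (swap-punchIn-inject₁ c l))
          = negate (sign (toℕ (inject₁ c))) (A zero (suc c)) (det (minor (suc c) A))
    ... | no _ | yes refl rewrite swap-suc c | sign-swap c
          | det-cong {B = minor (inject₁ c) A} (λ i l → cong (A (suc i)) (swap-punchIn-suc c l))
          = negate′ (sign (toℕ (inject₁ c))) (A zero (inject₁ c)) (det (minor (inject₁ c) A))
    ... | no j≢c | no j≢c+1 with c′ , eq ← swap-punchIn c j j≢c j≢c+1
          rewrite swap-fix c j j≢c j≢c+1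
          | det-cong {B = λ i l → minor j A i (swap c′ l)} (λ i l → cong (A (suc i)) (eq l))
          | det-swapColumns c′ (minor j A)
          = negate″ (sign (toℕ j)) (A zero j) (det (minor j A))

  punchIn-punchOut-comm : ∀ {k} {a b : Fin (suc (suc k))} (a≢b : a ≢ b) (b≢a : b ≢ a) m →
    punchIn a (punchIn (punchOut a≢b) m) ≡ punchIn b (punchIn (punchOut b≢a) m)
  punchIn-punchOut-comm {a = zero}  {zero}  a≢b _ m = ⊥-elim (a≢b refl)
  punchIn-punchOut-comm {a = zero}  {suc b} _   _ m = refl
  punchIn-punchOut-comm {a = suc a} {zero}  _   _ m = refl
  punchIn-punchOut-comm {zero}  {suc zero} {suc zero} a≢b _ m = ⊥-elim (a≢b refl)
  punchIn-punchOut-comm {suc k} {suc a} {suc b} a≢b b≢a zero    = refl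
  punchIn-punchOut-comm {suc k} {suc a} {suc b} a≢b b≢a (suc m) =
    cong suc (punchIn-punchOut-comm (a≢b ∘ cong suc) (b≢a ∘ cong suc) m)

  sign-punchOut-anti : ∀ {k} {a b : Fin (suc (suc k))} (a≢b : a ≢ b) (b≢a : b ≢ a) →
    sign (toℕ a) * sign (toℕ (punchOut a≢b)) ≡ - (sign (toℕ b) * sign (toℕ (punchOut b≢a)))
  sign-punchOut-anti {a = zero}  {zero}  a≢b _ = ⊥-elim (a≢b refl)
  sign-punchOut-anti {a = zero}  {suc b} _   _ rewrite sign-suc (toℕ b) = sign-flip (sign (toℕ b))
    where
    sign-flip : ∀ s → 1ℤ * s ≡ - (- s * 1ℤ)
    sign-flip = solve-∀
  sign-punchOut-anti {a = suc a} {zero}  _   _ rewrite sign-suc (toℕ a) = sign-flip (sign (toℕ a))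
    where
    sign-flip : ∀ s → - s * 1ℤ ≡ - (1ℤ * s)
    sign-flip = solve-∀
  sign-punchOut-anti {zero}  {suc zero} {suc zero} a≢b _ = ⊥-elim (a≢b refl)
  sign-punchOut-anti {suc k} {suc a} {suc b} a≢b b≢a
    rewrite sign-suc (toℕ a) | sign-suc (toℕ b)
          | sign-suc (toℕ (punchOut (a≢b ∘ cong suc))) | sign-suc (toℕ (punchOut (b≢a ∘ cong suc)))
    = trans (neg*neg (sign (toℕ a)) _)
            (trans (sign-punchOut-anti (a≢b ∘ cong suc) (b≢a ∘ cong suc))
                   (cong -_ (sym (neg*neg (sign (toℕ b)) _))))
    where
    neg*neg : ∀ s t → - s * - t ≡ s * t
    neg*neg = solve-∀

  punchOut-punchIn′ : ∀ {k} {a : Fin (suc k)} {l} (a≢ : a ≢ punchIn a l) → punchOut a≢ ≡ l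
  punchOut-punchIn′ {a = a} a≢ = trans (punchOut-cong a refl) (punchOut-punchIn a)

  module _ {k : ℕ} (B : Matrix (suc (suc k))) where

    pairMinor : {a b : Fin (suc (suc k))} → a ≢ b → Matrix k
    pairMinor {a} a≢b i m = B (suc (suc i)) (punchIn a (punchIn (punchOut a≢b) m))

    pairSign : {a b : Fin (suc (suc k))} → a ≢ b → ℤ
    pairSign {a} a≢b = sign (toℕ a) * sign (toℕ (punchOut a≢b))

    -- The cofactor of the entries (0 , a) and (1 , b) in the expansion along the first two rows.
    pairCofactor : {a b : Fin (suc (suc k))} → a ≢ b → ℤ
    pairCofactor a≢b = pairSign a≢b * det (pairMinor a≢b)

    pairTerm : Fin (suc (suc k)) → Fin (suc (suc k)) → ℤ
    pairTerm a b with a ≟ b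
    ... | yes _   = 0ℤ
    ... | no a≢b = B zero a * B (suc zero) b * pairCofactor a≢b

    pairTerm-diagonal : ∀ a → pairTerm a a ≡ 0ℤ
    pairTerm-diagonal a with a ≟ a
    ... | yes _   = refl
    ... | no a≢a = ⊥-elim (a≢a refl)

    pairCofactor-anti : ∀ {a b} (a≢b : a ≢ b) (b≢a : b ≢ a) → pairCofactor a≢b ≡ - pairCofactor b≢a
    pairCofactor-anti a≢b b≢a = trans
      (cong₂ _*_ (sign-punchOut-anti a≢b b≢a)
                 (det-cong λ i m → cong (B (suc (suc i))) (punchIn-punchOut-comm a≢b b≢a m)))
      (sym (neg-distribˡ-* (pairSign b≢a) (det (pairMinor b≢a))))

    pairCofactor-punchIn : ∀ {a l} (a≢ : a ≢ punchIn a l) →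
      pairCofactor a≢ ≡ sign (toℕ a) * sign (toℕ l) * det (minor l (minor a B))
    pairCofactor-punchIn {a} a≢ = cong₂ (λ p d → sign (toℕ a) * sign (toℕ p) * d) (punchOut-punchIn′ a≢)
      (det-cong λ i m → cong (λ p → B (suc (suc i)) (punchIn a (punchIn p m))) (punchOut-punchIn′ a≢))

    pairTerm-punchIn : ∀ a l → pairTerm a (punchIn a l) ≡
      sign (toℕ a) * (B zero a * (sign (toℕ l) * (B (suc zero) (punchIn a l) * det (minor l (minor a B)))))
    pairTerm-punchIn a l with a ≟ punchIn a l
    ... | yes a≡ = ⊥-elim (punchInᵢ≢i a l (sym a≡))
    ... | no a≢ = trans (cong (B zero a * B (suc zero) (punchIn a l) *_) (pairCofactor-punchIn a≢))
      (regroup (B zero a) (B (suc zero) (punchIn a l)) (sign (toℕ a)) (sign (toℕ l))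
               (det (minor l (minor a B))))
      where
      regroup : ∀ x y s t d → x * y * (s * t * d) ≡ s * (x * (t * (y * d)))
      regroup = solve-∀

    det-pairExpansion : det B ≡ sumFin λ a → sumFin (pairTerm a)
    det-pairExpansion = sumFin-cong λ a → begin
      sign (toℕ a) * (B zero a * sumFin (laplaceTerm (minor a B)))
        ≡⟨ cong (sign (toℕ a) *_) (*-sumFin (B zero a) (laplaceTerm (minor a B))) ⟩
      sign (toℕ a) * sumFin (λ l → B zero a * laplaceTerm (minor a B) l)
        ≡⟨ *-sumFin (sign (toℕ a)) (λ l → B zero a * laplaceTerm (minor a B) l) ⟩
      sumFin (λ l → sign (toℕ a) * (B zero a * laplaceTerm (minor a B) l))
        ≡⟨ sumFin-cong (λ l → sym (pairTerm-punchIn a l)) ⟩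
      sumFin (pairTerm a ∘ punchIn a)
        ≡⟨ sym (+-identityˡ _) ⟩
      0ℤ + sumFin (pairTerm a ∘ punchIn a)
        ≡⟨ cong (_+ sumFin (pairTerm a ∘ punchIn a)) (sym (pairTerm-diagonal a)) ⟩
      pairTerm a a + sumFin (pairTerm a ∘ punchIn a)
        ≡⟨ sym (sumFin-punchIn a (pairTerm a)) ⟩
      sumFin (pairTerm a) ∎
      where open ≡-Reasoning

  pairTerm-swapRows : ∀ {k} (B : Matrix (suc (suc k))) a b →
    pairTerm (λ i → B (swap zero i)) a b ≡ - pairTerm B b a
  pairTerm-swapRows B a b with a ≟ b | b ≟ a
  ... | yes _    | yes _    = refl
  ... | yes refl | no b≢a   = ⊥-elim (b≢a refl)
  ... | no a≢b   | yes refl = ⊥-elim (a≢b refl)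
  ... | no a≢b   | no b≢a   =
    trans (cong (B (suc zero) a * B zero b *_) (pairCofactor-anti B a≢b b≢a))
          (regroup (B (suc zero) a) (B zero b) (pairCofactor B b≢a))
    where
    regroup : ∀ x y c → x * y * - c ≡ - (y * x * c)
    regroup = solve-∀

  det-swapRows : ∀ {k} (r : Fin k) (A : Matrix (suc k)) → det (λ i → A (swap r i)) ≡ - det A
  det-swapRows {suc k} zero A = begin
    det A′                                          ≡⟨ det-pairExpansion A′ ⟩
    sumFin (λ a → sumFin (pairTerm A′ a))           ≡⟨ sumFin-cong (λ a → sumFin-cong (pairTerm-swapRows A a)) ⟩
    sumFin (λ a → sumFin (λ b → - pairTerm A b a))  ≡⟨ sumFin-cong (λ a → sumFin-neg (λ b → pairTerm A b a)) ⟩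
    sumFin (λ a → - sumFin (λ b → pairTerm A b a))  ≡⟨ sumFin-neg (λ a → sumFin (λ b → pairTerm A b a)) ⟩
    - sumFin (λ a → sumFin (λ b → pairTerm A b a))  ≡⟨ cong -_ (sym (sumFin-comm (pairTerm A))) ⟩
    - sumFin (λ b → sumFin (pairTerm A b))          ≡⟨ cong -_ (sym (det-pairExpansion A)) ⟩
    - det A                                         ∎
    where
    open ≡-Reasoning
    A′ : Matrix (suc (suc k))
    A′ i = A (swap zero i)
  det-swapRows {suc k} (suc r) A = trans (sumFin-cong term-swap) (sumFin-neg (laplaceTerm A))
    where
    pull-neg : ∀ s a d → s * (a * - d) ≡ - (s * (a * d))
    pull-neg = solve-∀
    term-swap : ∀ j → laplaceTerm (λ i → A (swap (suc r) i)) j ≡ - laplaceTerm A j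
    term-swap j = trans (cong (λ d → sign (toℕ j) * (A zero j * d)) (det-swapRows r (minor j A)))
                        (pull-neg (sign (toℕ j)) (A zero j) (det (minor j A)))

  det-conjugate-swap : ∀ {k} (c : Fin k) (A : Matrix (suc k)) →
    det (λ i j → A (swap c i) (swap c j)) ≡ det A
  det-conjugate-swap c A = begin
    det (λ i j → A (swap c i) (swap c j)) ≡⟨ det-swapRows c (λ i j → A i (swap c j)) ⟩
    - det (λ i j → A i (swap c j))        ≡⟨ cong -_ (det-swapColumns c A) ⟩
    - - det A                             ≡⟨ neg-involutive (det A) ⟩
    det A                                 ∎
    where open ≡-Reasoning

  data SwapProduct : ∀ {n} → (Fin n → Fin n) → Set where
    []  : ∀ {n} → SwapProduct {n} (λ x → x)
    _∷_ : ∀ {k} (c : Fin k) {σ} → SwapProduct σ → SwapProduct (swap c ∘ σ)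
    ext : ∀ {n} {σ τ : Fin n → Fin n} → (∀ x → σ x ≡ τ x) → SwapProduct σ → SwapProduct τ

  det-conjugate-SwapProduct : ∀ {k} {σ : Fin k → Fin k} → SwapProduct σ →
    (A : Matrix k) → det (λ i j → A (σ i) (σ j)) ≡ det A
  det-conjugate-SwapProduct []          A = refl
  det-conjugate-SwapProduct (c ∷ σ)     A =
    trans (det-conjugate-SwapProduct σ λ a b → A (swap c a) (swap c b)) (det-conjugate-swap c A)
  det-conjugate-SwapProduct (ext σ≗τ σ) A =
    trans (det-cong λ i j → cong₂ A (sym (σ≗τ i)) (sym (σ≗τ j))) (det-conjugate-SwapProduct σ A)

  SwapProduct-lift : ∀ {n} {σ : Fin n → Fin n} → SwapProduct σ → SwapProduct (lift 1 σ)
  SwapProduct-lift []          = ext (λ { zero → refl ; (suc x) → refl }) []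
  SwapProduct-lift (c ∷ σ)     = ext (λ { zero → refl ; (suc x) → refl }) (suc c ∷ SwapProduct-lift σ)
  SwapProduct-lift (ext σ≗τ σ) = ext (λ { zero → refl ; (suc x) → cong suc (σ≗τ x) }) (SwapProduct-lift σ)

  SwapProduct-∘ : ∀ {n} {σ τ : Fin n → Fin n} → SwapProduct σ → SwapProduct τ → SwapProduct (σ ∘ τ)
  SwapProduct-∘ []            τ = τ
  SwapProduct-∘ (c ∷ σ)       τ = c ∷ SwapProduct-∘ σ τ
  SwapProduct-∘ {τ = τ′} (ext σ≗ρ σ) τ = ext (σ≗ρ ∘ τ′) (SwapProduct-∘ σ τ)

  cycleTo : ∀ {k} → Fin (suc k) → Fin (suc k) → Fin (suc k)
  cycleTo a zero    = a
  cycleTo a (suc i) = punchIn a i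

  SwapProduct-cycleTo : ∀ {k} (a : Fin (suc k)) → SwapProduct (cycleTo a)
  SwapProduct-cycleTo zero            = ext (λ { zero → refl ; (suc x) → refl }) []
  SwapProduct-cycleTo {suc k} (suc a) = ext (λ { zero → refl ; (suc zero) → refl ; (suc (suc i)) → refl })
    (SwapProduct-∘ (SwapProduct-lift (SwapProduct-cycleTo a)) (zero ∷ []))

  injective⇒SwapProduct : ∀ {n} (σ : Fin n → Fin n) → Injective _≡_ _≡_ σ → SwapProduct σ
  injective⇒SwapProduct {zero}  σ σ-inj = ext (λ ()) []
  injective⇒SwapProduct {suc k} σ σ-inj =
    ext factor (SwapProduct-∘ (SwapProduct-cycleTo (σ zero))
                              (SwapProduct-lift (injective⇒SwapProduct σ′ σ′-inj)))
    where
    σ0≢ : ∀ i → σ zero ≢ σ (suc i)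
    σ0≢ i eq with () ← σ-inj eq
    σ′ : Fin k → Fin k
    σ′ i = punchOut (σ0≢ i)
    σ′-inj : Injective _≡_ _≡_ σ′
    σ′-inj eq = suc-injective (σ-inj (punchOut-injective (σ0≢ _) (σ0≢ _) eq))
    factor : ∀ x → cycleTo (σ zero) (lift 1 σ′ x) ≡ σ x
    factor zero    = refl
    factor (suc i) = punchIn-punchOut (σ0≢ i)

  det-conjugate : ∀ {k} (σ : Fin k → Fin k) → Injective _≡_ _≡_ σ →
    (A : Matrix k) → det (λ i j → A (σ i) (σ j)) ≡ det A
  det-conjugate σ σ-inj = det-conjugate-SwapProduct (injective⇒SwapProduct σ σ-inj)

  charPolyAt-cong : ∀ {k} {M N : Matrix k} → (∀ i j → M i j ≡ N i j) → ∀ x → charPolyAt M x ≡ charPolyAt N x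
  charPolyAt-cong M≗N x = det-cong λ i j → cong (λ m → (if does (i ≟ j) then x else 0ℤ) - m) (M≗N i j)

  charPolyAt-conjugate : ∀ {k} (σ : Fin k → Fin k) → Injective _≡_ _≡_ σ →
    (M : Matrix k) (x : ℤ) → charPolyAt (λ i j → M (σ i) (σ j)) x ≡ charPolyAt M x
  charPolyAt-conjugate σ σ-inj M x =
    trans (det-cong λ i j → cong (λ b → (if b then x else 0ℤ) - M (σ i) (σ j)) (does-≟-injective i j))
          (det-conjugate σ σ-inj λ a b → (if does (a ≟ b) then x else 0ℤ) - M a b)
    where
    does-≟-injective : ∀ i j → does (i ≟ j) ≡ does (σ i ≟ σ j)
    does-≟-injective i j with i ≟ j | σ i ≟ σ j
    ... | yes _    | yes _     = refl
    ... | no _     | no _      = refl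
    ... | yes refl | no σi≢σi  = ⊥-elim (σi≢σi refl)
    ... | no i≢j   | yes σi≡σj = ⊥-elim (i≢j (σ-inj σi≡σj))

module Polynomial where

  open Determinant using (Matrix; sumFin-cong; det-cong)
  open import Data.Nat using (ℕ; zero; suc)
  open import Data.Integer as ℤ using (ℤ; +[1+_]; -[1+_]; _+_; _-_; _*_; _^_; -_; 0ℤ; 1ℤ)
  open import Data.Integer.Properties using (+-identityˡ; +-identityʳ; *-zeroʳ)
  open import Data.Integer.Tactic.RingSolver using (solve-∀)
  open import Data.List using (List; []; _∷_)
  open import Data.Vec using (Vec; _∷_; lookup; tabulate; removeAt; map)
  open import Data.Vec.Properties using (lookup-map; lookup∘tabulate; removeAt-punchOut)
  open import Data.Fin using (Fin; zero; suc; toℕ; punchIn; _≟_)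
  open import Data.Fin.Properties using (punchInᵢ≢i; punchOut-punchIn)
  open import Data.Bool using (true; false; if_then_else_)
  open import Relation.Nullary using (does)
  open import Function using (_∘_)
  open import Relation.Binary.PropositionalEquality
    using (_≡_; refl; sym; trans; cong; cong₂; module ≡-Reasoning)

  Poly : Set
  Poly = List ℤ

  eval : Poly → ℤ → ℤ
  eval []      x = 0ℤ
  eval (a ∷ p) x = a + x * eval p x

  infixl 6 _+ᴾ_
  infixl 7 _*ᴾ_ _·ᴾ_
  infixr 8 _^ᴾ_

  _+ᴾ_ : Poly → Poly → Poly
  []      +ᴾ q       = q
  (a ∷ p) +ᴾ []      = a ∷ p
  (a ∷ p) +ᴾ (b ∷ q) = a + b ∷ p +ᴾ q

  _·ᴾ_ : ℤ → Poly → Poly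
  c ·ᴾ []      = []
  c ·ᴾ (b ∷ q) = c * b ∷ c ·ᴾ q

  -- A zero left factor ([]) short-circuits the product, so `detᴾ` never expands the minors of
  -- zero entries.
  _*ᴾ_ : Poly → Poly → Poly
  []      *ᴾ q = []
  (a ∷ p) *ᴾ q = a ·ᴾ q +ᴾ (0ℤ ∷ p *ᴾ q)

  _^ᴾ_ : Poly → ℕ → Poly
  p ^ᴾ zero  = 1ℤ ∷ []
  p ^ᴾ suc m = p *ᴾ p ^ᴾ m

  Xᴾ : Poly
  Xᴾ = 0ℤ ∷ 1ℤ ∷ []

  constᴾ : ℤ → Poly
  constᴾ (ℤ.+ 0) = []
  constᴾ c       = c ∷ []

  eval-[c] : ∀ c x → eval (c ∷ []) x ≡ c
  eval-[c] c x = trans (cong (c +_) (*-zeroʳ x)) (+-identityʳ c)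

  eval-constᴾ : ∀ c x → eval (constᴾ c) x ≡ c
  eval-constᴾ (ℤ.+ 0)      x = refl
  eval-constᴾ c@(+[1+ _ ]) x = eval-[c] c x
  eval-constᴾ c@(-[1+ _ ]) x = eval-[c] c x

  eval-Xᴾ : ∀ x → eval Xᴾ x ≡ x
  eval-Xᴾ = horner
    where
    horner : ∀ x → 0ℤ + x * (1ℤ + x * 0ℤ) ≡ x
    horner = solve-∀

  eval-+ᴾ : ∀ p q x → eval (p +ᴾ q) x ≡ eval p x + eval q x
  eval-+ᴾ []      q       x = sym (+-identityˡ _)
  eval-+ᴾ (a ∷ p) []      x = sym (+-identityʳ _)
  eval-+ᴾ (a ∷ p) (b ∷ q) x rewrite eval-+ᴾ p q x = shuffle a b (eval p x) (eval q x) x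
    where
    shuffle : ∀ a b u v x → a + b + x * (u + v) ≡ a + x * u + (b + x * v)
    shuffle = solve-∀

  eval-·ᴾ : ∀ c q x → eval (c ·ᴾ q) x ≡ c * eval q x
  eval-·ᴾ c []      x = sym (*-zeroʳ c)
  eval-·ᴾ c (b ∷ q) x rewrite eval-·ᴾ c q x = distrib c b (eval q x) x
    where
    distrib : ∀ c b u x → c * b + x * (c * u) ≡ c * (b + x * u)
    distrib = solve-∀

  eval-*ᴾ : ∀ p q x → eval (p *ᴾ q) x ≡ eval p x * eval q x
  eval-*ᴾ []      q x = refl
  eval-*ᴾ (a ∷ p) q x
    rewrite eval-+ᴾ (a ·ᴾ q) (0ℤ ∷ p *ᴾ q) x | eval-·ᴾ a q x | eval-*ᴾ p q x
    = horner a (eval p x) (eval q x) x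
    where
    horner : ∀ a u v x → a * v + (0ℤ + x * (u * v)) ≡ (a + x * u) * v
    horner = solve-∀

  eval-^ᴾ : ∀ p m x → eval (p ^ᴾ m) x ≡ eval p x ^ m
  eval-^ᴾ p zero    x = eval-[c] 1ℤ x
  eval-^ᴾ p (suc m) x = trans (eval-*ᴾ p (p ^ᴾ m) x) (cong (eval p x *_) (eval-^ᴾ p m x))

  sumᴾ : ∀ {k} → (Fin k → Poly) → Poly
  sumᴾ {zero}  f = []
  sumᴾ {suc k} f = f zero +ᴾ sumᴾ (λ i → f (suc i))

  eval-sumᴾ : ∀ {k} (f : Fin k → Poly) x → eval (sumᴾ f) x ≡ sumFin (λ i → eval (f i) x)
  eval-sumᴾ {zero}  f x = refl
  eval-sumᴾ {suc k} f x rewrite eval-+ᴾ (f zero) (sumᴾ (λ i → f (suc i))) x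
    = cong (eval (f zero) x +_) (eval-sumᴾ (λ i → f (suc i)) x)

  -- The matrix is stored as nested vectors rather than a function: a vector is not re-evaluated
  -- at every lookup, which keeps `detᴾ` computable.
  detᴾ : ∀ {k} → Vec (Vec Poly k) k → Poly
  detᴾ {zero}  _        = 1ℤ ∷ []
  detᴾ {suc k} (r ∷ rs) = sumᴾ λ j →
    sign (toℕ j) ·ᴾ (lookup r j *ᴾ detᴾ (map (λ row → removeAt row j) rs))

  lookup-removeAt : ∀ {k} {A : Set} (xs : Vec A (suc k)) j l →
    lookup (removeAt xs j) l ≡ lookup xs (punchIn j l)
  lookup-removeAt xs j l =
    trans (cong (lookup (removeAt xs j)) (sym (punchOut-punchIn j)))
          (removeAt-punchOut xs (punchInᵢ≢i j l ∘ sym))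

  evalMatrix : ∀ {k} → Vec (Vec Poly k) k → ℤ → Matrix k
  evalMatrix A x i j = eval (lookup (lookup A i) j) x

  eval-detᴾ : ∀ {k} (A : Vec (Vec Poly k) k) x → eval (detᴾ A) x ≡ det (evalMatrix A x)
  eval-detᴾ {zero}  _        x = eval-[c] 1ℤ x
  eval-detᴾ {suc k} (r ∷ rs) x = trans (eval-sumᴾ term x) (sumFin-cong λ j → begin
    eval (term j) x
      ≡⟨ eval-·ᴾ (sign (toℕ j)) (lookup r j *ᴾ detᴾ (minor j)) x ⟩
    sign (toℕ j) * eval (lookup r j *ᴾ detᴾ (minor j)) x
      ≡⟨ cong (sign (toℕ j) *_) (eval-*ᴾ (lookup r j) (detᴾ (minor j)) x) ⟩
    sign (toℕ j) * (eval (lookup r j) x * eval (detᴾ (minor j)) x)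
      ≡⟨ cong (λ d → sign (toℕ j) * (eval (lookup r j) x * d)) (eval-detᴾ (minor j) x) ⟩
    sign (toℕ j) * (eval (lookup r j) x * det (evalMatrix (minor j) x))
      ≡⟨ cong (λ d → sign (toℕ j) * (eval (lookup r j) x * d)) (det-cong (minor-entry j)) ⟩
    sign (toℕ j) * (eval (lookup r j) x * det (λ i l → evalMatrix (r ∷ rs) x (suc i) (punchIn j l))) ∎)
    where
    open ≡-Reasoning
    minor : Fin (suc k) → Vec (Vec Poly k) k
    minor j = map (λ row → removeAt row j) rs
    term : Fin (suc k) → Poly
    term j = sign (toℕ j) ·ᴾ (lookup r j *ᴾ detᴾ (minor j))
    minor-entry : ∀ j i l → evalMatrix (minor j) x i l ≡ evalMatrix (r ∷ rs) x (suc i) (punchIn j l)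
    minor-entry j i l = cong (λ p → eval p x)
      (trans (cong (λ row → lookup row l) (lookup-map i (λ row → removeAt row j) rs))
             (lookup-removeAt (lookup rs i) j l))

  charEntryᴾ : ∀ {k} → Matrix k → Fin k → Fin k → Poly
  charEntryᴾ M i j = (if does (i ≟ j) then Xᴾ else []) +ᴾ constᴾ (- M i j)

  eval-charEntryᴾ : ∀ {k} (M : Matrix k) i j x →
    eval (charEntryᴾ M i j) x ≡ (if does (i ≟ j) then x else 0ℤ) - M i j
  eval-charEntryᴾ M i j x = trans (eval-+ᴾ (if does (i ≟ j) then Xᴾ else []) (constᴾ (- M i j)) x)
    (cong₂ _+_ (eval-diagonal (does (i ≟ j))) (eval-constᴾ (- M i j) x))
    where
    eval-diagonal : ∀ b → eval (if b then Xᴾ else []) x ≡ (if b then x else 0ℤ)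
    eval-diagonal true  = eval-Xᴾ x
    eval-diagonal false = refl

  charMatrixᴾ : ∀ {k} → Matrix k → Vec (Vec Poly k) k
  charMatrixᴾ M = tabulate λ i → tabulate (charEntryᴾ M i)

  charPolyᴾ : ∀ {k} → Matrix k → Poly
  charPolyᴾ M = detᴾ (charMatrixᴾ M)

  eval-charPolyᴾ : ∀ {k} (M : Matrix k) x → eval (charPolyᴾ M) x ≡ charPolyAt M x
  eval-charPolyᴾ M x = trans (eval-detᴾ (charMatrixᴾ M) x) (det-cong λ i j → begin
    eval (lookup (lookup (charMatrixᴾ M) i) j) x
      ≡⟨ cong (λ row → eval (lookup row j) x) (lookup∘tabulate (λ i → tabulate (charEntryᴾ M i)) i) ⟩
    eval (lookup (tabulate (charEntryᴾ M i)) j) x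
      ≡⟨ cong (λ e → eval e x) (lookup∘tabulate (charEntryᴾ M i) j) ⟩
    eval (charEntryᴾ M i j) x
      ≡⟨ eval-charEntryᴾ M i j x ⟩
    (if does (i ≟ j) then x else 0ℤ) - M i j ∎)
    where open ≡-Reasoning

module TargetPolynomial where

  open Polynomial using (Poly; eval; _*ᴾ_; _^ᴾ_; eval-*ᴾ; eval-^ᴾ)
  open import Data.Integer as ℤ using (_+_; _-_; _*_; _^_; -_; 0ℤ; 1ℤ; -1ℤ)
  open import Data.Integer.Tactic.RingSolver using (solve-∀)
  open import Data.List using ([]; _∷_)
  open import Relation.Binary.PropositionalEquality using (_≡_; cong; cong₂; module ≡-Reasoning)

  x²-5x+1 x-1 x²+3x+1 x+1 : Poly
  x²-5x+1 = 1ℤ ∷ - ℤ.+ 5 ∷ 1ℤ ∷ []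
  x-1     = -1ℤ ∷ 1ℤ ∷ []
  x²+3x+1 = 1ℤ ∷ ℤ.+ 3 ∷ 1ℤ ∷ []
  x+1     = 1ℤ ∷ 1ℤ ∷ []

  targetᴾ : Poly
  targetᴾ = x²-5x+1 *ᴾ x-1 ^ᴾ 5 *ᴾ x²+3x+1 ^ᴾ 3 *ᴾ x+1

  eval-targetᴾ : ∀ x → eval targetᴾ x ≡ targetPoly x
  eval-targetᴾ x = begin
    eval targetᴾ x
      ≡⟨ eval-*ᴾ (x²-5x+1 *ᴾ x-1 ^ᴾ 5 *ᴾ x²+3x+1 ^ᴾ 3) x+1 x ⟩
    eval (x²-5x+1 *ᴾ x-1 ^ᴾ 5 *ᴾ x²+3x+1 ^ᴾ 3) x * eval x+1 x
      ≡⟨ cong (_* eval x+1 x) (eval-*ᴾ (x²-5x+1 *ᴾ x-1 ^ᴾ 5) (x²+3x+1 ^ᴾ 3) x) ⟩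
    eval (x²-5x+1 *ᴾ x-1 ^ᴾ 5) x * eval (x²+3x+1 ^ᴾ 3) x * eval x+1 x
      ≡⟨ cong (λ u → u * eval (x²+3x+1 ^ᴾ 3) x * eval x+1 x) (eval-*ᴾ x²-5x+1 (x-1 ^ᴾ 5) x) ⟩
    eval x²-5x+1 x * eval (x-1 ^ᴾ 5) x * eval (x²+3x+1 ^ᴾ 3) x * eval x+1 x
      ≡⟨ cong₂ (λ b c → eval x²-5x+1 x * b * c * eval x+1 x) (eval-^ᴾ x-1 5 x) (eval-^ᴾ x²+3x+1 3 x) ⟩
    eval x²-5x+1 x * eval x-1 x ^ 5 * eval x²+3x+1 x ^ 3 * eval x+1 x
      ≡⟨ cong₂ (λ a b → a * b ^ 5 * eval x²+3x+1 x ^ 3 * eval x+1 x) (eval-x²-5x+1 x) (eval-x-1 x) ⟩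
    (x * x - ℤ.+ 5 * x + 1ℤ) * (x - 1ℤ) ^ 5 * eval x²+3x+1 x ^ 3 * eval x+1 x
      ≡⟨ cong₂ (λ c d → (x * x - ℤ.+ 5 * x + 1ℤ) * (x - 1ℤ) ^ 5 * c ^ 3 * d) (eval-x²+3x+1 x) (eval-x+1 x) ⟩
    targetPoly x ∎
    where
    open ≡-Reasoning
    -- Stated with `eval` unfolded: the ring solver cannot see through `eval`.
    eval-x²-5x+1 : ∀ x → 1ℤ + x * (- ℤ.+ 5 + x * (1ℤ + x * 0ℤ)) ≡ x * x - ℤ.+ 5 * x + 1ℤ
    eval-x²-5x+1 = solve-∀
    eval-x-1 : ∀ x → -1ℤ + x * (1ℤ + x * 0ℤ) ≡ x - 1ℤ
    eval-x-1 = solve-∀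
    eval-x²+3x+1 : ∀ x → 1ℤ + x * (ℤ.+ 3 + x * (1ℤ + x * 0ℤ)) ≡ x * x + ℤ.+ 3 * x + 1ℤ
    eval-x²+3x+1 = solve-∀
    eval-x+1 : ∀ x → 1ℤ + x * (1ℤ + x * 0ℤ) ≡ x + 1ℤ
    eval-x+1 = solve-∀

module ℤₙIdeals where

  open import Data.Nat using (ℕ; zero; suc; NonZero; pred; _+_; _*_; _<_)
  open import Data.Nat.Properties using (suc-pred; +-comm; +-identityʳ; m≤n⇒m<n∨m≡n; ≤-pred; m+[n∸m]≡n; <⇒≤)
  open import Data.Nat.DivMod using (_%_; m%n<n; m<n⇒m%n≡m; [m+kn]%n≡m%n; %-distribˡ-+; %-distribˡ-*)
  open import Data.Nat.Divisibility
    using ( _∣_; divides; _∣?_; _∣0; ∣-refl; ∣-antisym; ∣-trans; ∣n⇒∣m*n; ∣m∣n⇒∣m+n; ∣m+n∣m⇒∣n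
          ; n∣m⇒m%n≡0; m%n≡0⇒n∣m; %-presˡ-∣; ∣n∣m%n⇒∣m)
  open import Data.Nat.GCD using (gcd; gcd[m,n]∣m; gcd[m,n]∣n; gcd-GCD; module Bézout)
  open import Data.Nat.Tactic.RingSolver using (solve-∀)
  open import Data.Fin using (Fin; toℕ; fromℕ<)
  open import Data.Fin.Properties using (toℕ-fromℕ<; toℕ-injective; toℕ<n)
  open import Data.Fin.Subset using (Subset; _∈_)
  open import Data.Fin.Subset.Properties using (_∈?_; ⊆-antisym)
  open import Data.Bool using (if_then_else_)
  open import Data.Product using (_,_)
  open import Data.Sum using (inj₁; inj₂)
  open import Data.Empty using (⊥-elim)
  open import Relation.Nullary using (Dec; does; yes; no)
  open import Function.Bundles using (_⇔_; mk⇔; Equivalence)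
  open import Relation.Nullary.Decidable using (recompute; isYes; toWitness; fromWitness)
  open import Relation.Unary using (Decidable)
  open import Data.Bool.Properties using (T-≡)
  open import Data.Vec using (tabulate)
  open import Data.Vec.Properties using (lookup∘tabulate; lookup⇒[]=; []=⇒lookup)
  open import Function using (_∘_)
  open import Relation.Binary.PropositionalEquality

  module _ {n : ℕ} {{_ : NonZero n}} where

    [_]ₙ : ℕ → Fin n
    [ k ]ₙ = fromℕ< (m%n<n k n)

    toℕ-[]ₙ : ∀ k → toℕ [ k ]ₙ ≡ k % n
    toℕ-[]ₙ k = toℕ-fromℕ< (m%n<n k n)

    []ₙ-cong : ∀ {a b} → a % n ≡ b % n → [ a ]ₙ ≡ [ b ]ₙ
    []ₙ-cong a≡b = toℕ-injective (trans (toℕ-[]ₙ _) (trans a≡b (sym (toℕ-[]ₙ _))))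

    [toℕ]ₙ : ∀ x → [ toℕ x ]ₙ ≡ x
    [toℕ]ₙ x = toℕ-injective (trans (toℕ-[]ₙ (toℕ x)) (m<n⇒m%n≡m (toℕ<n x)))

    toℕ-0ₙ : toℕ (0ₙ {n}) ≡ 0
    toℕ-0ₙ = trans (toℕ-[]ₙ 0) (n∣m⇒m%n≡0 0 n (n ∣0))

    n∣⇒[]ₙ≡0ₙ : ∀ {k} → n ∣ k → [ k ]ₙ ≡ 0ₙ
    n∣⇒[]ₙ≡0ₙ {k} n∣k = []ₙ-cong (trans (n∣m⇒m%n≡0 k n n∣k) (sym (n∣m⇒m%n≡0 0 n (n ∣0))))

    []ₙ≡0ₙ⇒n∣ : ∀ {k} → [ k ]ₙ ≡ 0ₙ → n ∣ k
    []ₙ≡0ₙ⇒n∣ {k} eq = m%n≡0⇒n∣m k n (trans (sym (toℕ-[]ₙ k)) (trans (cong toℕ eq) toℕ-0ₙ))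

    n∣⇒≡0ₙ : ∀ {x} → n ∣ toℕ x → x ≡ 0ₙ
    n∣⇒≡0ₙ {x} n∣x = trans (sym ([toℕ]ₙ x)) (n∣⇒[]ₙ≡0ₙ n∣x)

    infix 4 _∈ᴵ_
    _∈ᴵ_ : ℕ → Ideal n → Set
    k ∈ᴵ I = [ k ]ₙ ∈ carrier I

    ∈⇒∈ᴵ : ∀ I {x} → x ∈ carrier I → toℕ x ∈ᴵ I
    ∈⇒∈ᴵ I {x} = subst (_∈ carrier I) (sym ([toℕ]ₙ x))

    ∈ᴵ-% : ∀ I {a b} → a % n ≡ b % n → a ∈ᴵ I → b ∈ᴵ I
    ∈ᴵ-% I a≡b = subst (_∈ carrier I) ([]ₙ-cong a≡b)

    ∈ᴵ-0 : ∀ I → 0 ∈ᴵ I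
    ∈ᴵ-0 I@(mkIdeal _ 0∈ _ _ _) = recompute (_ ∈? carrier I) 0∈

    ∈ᴵ-+ : ∀ I {a b} → a ∈ᴵ I → b ∈ᴵ I → a + b ∈ᴵ I
    ∈ᴵ-+ I@(mkIdeal _ _ +-closed _ _) {a} {b} a∈ b∈ =
      ∈ᴵ-% I (trans (cong₂ (λ u v → (u + v) % n) (toℕ-[]ₙ a) (toℕ-[]ₙ b)) (sym (%-distribˡ-+ a b n)))
        (recompute (_ ∈? carrier I) (+-closed _ _ a∈ b∈))

    ∈ᴵ-* : ∀ I c {a} → a ∈ᴵ I → c * a ∈ᴵ I
    ∈ᴵ-* I@(mkIdeal _ _ _ _ *-closed) c {a} a∈ =
      ∈ᴵ-% I (trans (cong₂ (λ u v → (u * v) % n) (toℕ-[]ₙ c) (toℕ-[]ₙ a)) (sym (%-distribˡ-* c a n)))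
        (recompute (_ ∈? carrier I) (*-closed [ c ]ₙ _ a∈))

    ∈ᴵ-cancel : ∀ I {a b} → a + b ∈ᴵ I → a ∈ᴵ I → b ∈ᴵ I
    ∈ᴵ-cancel I {a} {b} a+b∈ a∈ = ∈ᴵ-% I (trans (cong (_% n) a+b+[n-1]a≡b+an) ([m+kn]%n≡m%n b a n))
      (∈ᴵ-+ I a+b∈ (∈ᴵ-* I (pred n) a∈))
      where
      identity : ∀ a b p → a + b + p * a ≡ b + a * suc p
      identity = solve-∀
      a+b+[n-1]a≡b+an : a + b + pred n * a ≡ b + a * n
      a+b+[n-1]a≡b+an = trans (identity a b (pred n)) (cong (λ m → b + a * m) (suc-pred n))

    ∈ᴵ-multiple : ∀ I {a b} → a ∈ᴵ I → a ∣ b → b ∈ᴵ I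
    ∈ᴵ-multiple I a∈ (divides c refl) = ∈ᴵ-* I c a∈

    ∈ᴵ-gcd : ∀ I {a b} → a ∈ᴵ I → b ∈ᴵ I → gcd a b ∈ᴵ I
    ∈ᴵ-gcd I {a} {b} a∈ b∈ with Bézout.identity (gcd-GCD a b)
    ... | Bézout.+- x y d+yb≡xa =
      ∈ᴵ-cancel I (subst (_∈ᴵ I) (trans (sym d+yb≡xa) (+-comm _ (y * b))) (∈ᴵ-* I x a∈)) (∈ᴵ-* I y b∈)
    ... | Bézout.-+ x y d+xa≡yb =
      ∈ᴵ-cancel I (subst (_∈ᴵ I) (trans (sym d+xa≡yb) (+-comm _ (x * a))) (∈ᴵ-* I y b∈)) (∈ᴵ-* I x a∈)

    n∈ᴵ : ∀ I → n ∈ᴵ I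
    n∈ᴵ I = subst (_∈ carrier I) (sym (n∣⇒[]ₙ≡0ₙ ∣-refl)) (∈ᴵ-0 I)

    _∈ᴵ?_ : ∀ k I → Dec (k ∈ᴵ I)
    k ∈ᴵ? I = [ k ]ₙ ∈? carrier I

    gcdFold : Ideal n → ℕ → ℕ → ℕ
    gcdFold I zero    acc = acc
    gcdFold I (suc k) acc = gcdFold I k (if does (k ∈ᴵ? I) then gcd k acc else acc)

    gcdFold-∣ : ∀ I k acc → gcdFold I k acc ∣ acc
    gcdFold-∣ I zero    acc = ∣-refl
    gcdFold-∣ I (suc k) acc with k ∈ᴵ? I
    ... | yes _ = ∣-trans (gcdFold-∣ I k (gcd k acc)) (gcd[m,n]∣n k acc)
    ... | no _  = gcdFold-∣ I k acc

    gcdFold-∣-member : ∀ I k acc {j} → j < k → j ∈ᴵ I → gcdFold I k acc ∣ j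
    gcdFold-∣-member I (suc k) acc {j} j<k+1 j∈ with k ∈ᴵ? I | m≤n⇒m<n∨m≡n (≤-pred j<k+1)
    ... | _     | inj₁ j<k = gcdFold-∣-member I k _ j<k j∈
    ... | yes _ | inj₂ refl = ∣-trans (gcdFold-∣ I k (gcd j acc)) (gcd[m,n]∣m j acc)
    ... | no j∉ | inj₂ refl = ⊥-elim (j∉ j∈)

    gcdFold-∈ : ∀ I k {acc} → acc ∈ᴵ I → gcdFold I k acc ∈ᴵ I
    gcdFold-∈ I zero    acc∈ = acc∈
    gcdFold-∈ I (suc k) acc∈ with k ∈ᴵ? I
    ... | yes k∈ = gcdFold-∈ I k (∈ᴵ-gcd I k∈ acc∈)
    ... | no _   = gcdFold-∈ I k acc∈

    generator : Ideal n → ℕ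
    generator I = gcdFold I n n

    generator∣n : ∀ I → generator I ∣ n
    generator∣n I = gcdFold-∣ I n n

    ∈⇔generator∣ : ∀ I x → x ∈ carrier I ⇔ generator I ∣ toℕ x
    ∈⇔generator∣ I x = mk⇔
      (λ x∈ → gcdFold-∣-member I n n (toℕ<n x) (∈⇒∈ᴵ I x∈))
      (λ g∣x → subst (_∈ carrier I) ([toℕ]ₙ x) (∈ᴵ-multiple I (gcdFold-∈ I n (n∈ᴵ I)) g∣x))

    ∣-[]ₙ : ∀ {d k} → d ∣ n → d ∣ k → d ∣ toℕ [ k ]ₙ
    ∣-[]ₙ {k = k} d∣n d∣k = subst (_ ∣_) (sym (toℕ-[]ₙ k)) (%-presˡ-∣ d∣k d∣n)

    ∣-[]ₙ⁻ : ∀ {d k} → d ∣ n → d ∣ toℕ [ k ]ₙ → d ∣ k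
    ∣-[]ₙ⁻ {k = k} d∣n d∣[k] = ∣n∣m%n⇒∣m d∣n (subst (_ ∣_) (toℕ-[]ₙ k) d∣[k])

    ∈-tabulate⇔ : ∀ {P : Fin n → Set} (P? : Decidable P) x → x ∈ tabulate (isYes ∘ P?) ⇔ P x
    ∈-tabulate⇔ P? x = mk⇔
      (λ x∈ → toWitness (Equivalence.from T-≡ (trans (sym (lookup∘tabulate (isYes ∘ P?) x)) ([]=⇒lookup x∈))))
      (λ Px → lookup⇒[]= x _ (trans (lookup∘tabulate (isYes ∘ P?) x) (Equivalence.to T-≡ (fromWitness Px))))

    multiplesOf : ℕ → Subset n
    multiplesOf d = tabulate (isYes ∘ (d ∣?_) ∘ toℕ)

    ∈-multiplesOf⇔ : ∀ d x → x ∈ multiplesOf d ⇔ d ∣ toℕ x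
    ∈-multiplesOf⇔ d = ∈-tabulate⇔ ((d ∣?_) ∘ toℕ)

    multiples : (d : ℕ) → d ∣ n → Ideal n
    multiples d d∣n = mkIdeal (multiplesOf d)
      (intro (∣-[]ₙ d∣n (d ∣0)))
      (λ a b a∈ b∈ → intro (∣-[]ₙ d∣n (∣m∣n⇒∣m+n (elim a∈) (elim b∈))))
      (λ a a∈ → intro (∣-[]ₙ d∣n (∣m+n∣m⇒∣n (subst (d ∣_) (sym (m+[n∸m]≡n (<⇒≤ (toℕ<n a)))) d∣n) (elim a∈))))
      (λ r a a∈ → intro (∣-[]ₙ d∣n (∣n⇒∣m*n (toℕ r) (elim a∈))))
      where
      intro : ∀ {x} → d ∣ toℕ x → x ∈ multiplesOf d
      intro = Equivalence.from (∈-multiplesOf⇔ d _)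
      elim : ∀ {x} → x ∈ multiplesOf d → d ∣ toℕ x
      elim = Equivalence.to (∈-multiplesOf⇔ d _)

    sameMultiples⇒≡ : ∀ {d e} → d ∣ n → e ∣ n →
      (∀ x → d ∣ toℕ x → e ∣ toℕ x) → (∀ x → e ∣ toℕ x → d ∣ toℕ x) → d ≡ e
    sameMultiples⇒≡ d∣n e∣n d⇒e e⇒d = ∣-antisym
      (∣-[]ₙ⁻ d∣n (e⇒d _ (∣-[]ₙ e∣n ∣-refl)))
      (∣-[]ₙ⁻ e∣n (d⇒e _ (∣-[]ₙ d∣n ∣-refl)))

    Vertex-≡ : {v w : Vertex n} → (∀ x → x ∈ carrier (ideal v) ⇔ x ∈ carrier (ideal w)) → v ≡ w
    Vertex-≡ {mkVertex (mkIdeal _ _ _ _ _) _ _} {mkVertex (mkIdeal _ _ _ _ _) _ _} v⇔w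
      with refl ← ⊆-antisym (Equivalence.to (v⇔w _)) (Equivalence.from (v⇔w _)) = refl

    +ₙ-identityʳ : ∀ x → x +ₙ 0ₙ ≡ x
    +ₙ-identityʳ x =
      trans ([]ₙ-cong (cong (λ z → (toℕ x + z) % n) toℕ-0ₙ))
            (trans (cong [_]ₙ (+-identityʳ (toℕ x))) ([toℕ]ₙ x))

    +ₙ-identityˡ : ∀ x → 0ₙ +ₙ x ≡ x
    +ₙ-identityˡ x = trans ([]ₙ-cong (cong (λ z → (z + toℕ x) % n) toℕ-0ₙ)) ([toℕ]ₙ x)

    ∈⇒∈Sumˡ : ∀ I K {x} → x ∈ carrier I → x ∈Sum[ I , K ]
    ∈⇒∈Sumˡ I K {x} x∈I = x , 0ₙ , x∈I , ∈ᴵ-0 K , sym (+ₙ-identityʳ x)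

    ∈⇒∈Sumʳ : ∀ I K {x} → x ∈ carrier K → x ∈Sum[ I , K ]
    ∈⇒∈Sumʳ I K {x} x∈K = 0ₙ , x , ∈ᴵ-0 I , x∈K , sym (+ₙ-identityˡ x)

module PrimeProducts where

  open import Data.Nat using (ℕ; zero; suc; _*_)
  open import Data.Nat.Properties using (*-comm; *-assoc)
  open import Data.Nat.Divisibility
    using (_∣_; divides; _∣?_; 1∣_; ∣1⇒≡1; m∣m*n; ∣n⇒∣m*n; *-cancelʳ-∣)
  open import Data.Nat.Coprimality as Coprimality using (Coprime; coprime-divisor)
  open import Data.Nat.Primality using (Prime; euclidsLemma; prime⇒irreducible; prime⇒nonZero; prime⇒nonTrivial)
  open import Data.Nat.Base using (nonTrivial⇒≢1)
  open import Data.Fin using (Fin; zero; suc)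
  open import Data.Fin.Properties using (suc-injective)
  open import Data.Fin.Subset using (Subset; inside; outside; _∈_)
  open import Data.Fin.Subset.Properties using (⊆-antisym)
  open import Data.Vec using ([]; _∷_; here; there)
  open import Data.Product as Product using (∃-syntax; _×_; _,_)
  open import Data.Sum using (inj₁; inj₂)
  open import Data.Empty using (⊥-elim)
  open import Function using (_∘_; id)
  open import Function.Definitions using (Injective)
  open import Relation.Nullary using (¬_; yes; no)
  open import Relation.Binary.PropositionalEquality

  ∏ : ∀ {k} → (Fin k → ℕ) → Subset k → ℕ
  ∏ p []            = 1
  ∏ p (inside  ∷ S) = p zero * ∏ (p ∘ suc) S
  ∏ p (outside ∷ S) = ∏ (p ∘ suc) S

  prime≢1 : ∀ {q} → Prime q → q ≢ 1
  prime≢1 q-prime = nonTrivial⇒≢1 {{prime⇒nonTrivial q-prime}}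

  prime∣prime⇒≡ : ∀ {q r} → Prime q → Prime r → q ∣ r → q ≡ r
  prime∣prime⇒≡ q-prime r-prime q∣r with prime⇒irreducible r-prime q∣r
  ... | inj₁ q≡1 = ⊥-elim (prime≢1 q-prime q≡1)
  ... | inj₂ q≡r = q≡r

  prime∤⇒coprime : ∀ {q m} → Prime q → ¬ q ∣ m → Coprime q m
  prime∤⇒coprime q-prime q∤m (i∣q , i∣m) with prime⇒irreducible q-prime i∣q
  ... | inj₁ i≡1    = i≡1
  ... | inj₂ refl   = ⊥-elim (q∤m i∣m)

  coprime⇒*∣ : ∀ {a b m} → Coprime a b → a ∣ m → b ∣ m → a * b ∣ m
  coprime⇒*∣ {a} {b} coprime a∣m (divides c refl)
    with divides e refl ← coprime-divisor coprime (subst (a ∣_) (*-comm c b) a∣m) = divides e (*-assoc e a b)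

  p∣∏ : ∀ {k} {p : Fin k → ℕ} {S i} → i ∈ S → p i ∣ ∏ p S
  p∣∏ {p = p} {inside  ∷ S} here        = m∣m*n (∏ (p ∘ suc) S)
  p∣∏ {p = p} {inside  ∷ S} (there i∈S) = ∣n⇒∣m*n (p zero) (p∣∏ {p = p ∘ suc} i∈S)
  p∣∏ {p = p} {outside ∷ S} (there i∈S) = p∣∏ {p = p ∘ suc} i∈S

  prime∣∏ : ∀ {k} {p : Fin k → ℕ} {q} S → Prime q → q ∣ ∏ p S → ∃[ i ] (i ∈ S × q ∣ p i)
  prime∣∏         []            q-prime q∣1 = ⊥-elim (prime≢1 q-prime (∣1⇒≡1 q∣1))
  prime∣∏ {p = p} (inside  ∷ S) q-prime q∣∏ with euclidsLemma (p zero) (∏ (p ∘ suc) S) q-prime q∣∏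
  ... | inj₁ q∣p₀ = zero , here , q∣p₀
  ... | inj₂ q∣∏′ with i , i∈S , q∣pᵢ ← prime∣∏ S q-prime q∣∏′ = suc i , there i∈S , q∣pᵢ
  prime∣∏ {p = p} (outside ∷ S) q-prime q∣∏
    with i , i∈S , q∣pᵢ ← prime∣∏ {p = p ∘ suc} S q-prime q∣∏ = suc i , there i∈S , q∣pᵢ

  ∣∏⇒≡∏ : ∀ {k} {p : Fin k → ℕ} → (∀ i → Prime (p i)) → ∀ S {d} → d ∣ ∏ p S → ∃[ T ] d ≡ ∏ p T
  ∣∏⇒≡∏ p-prime [] d∣1 = [] , ∣1⇒≡1 d∣1
  ∣∏⇒≡∏ {p = p} p-prime (inside ∷ S) {d} d∣∏ with p zero ∣? d
  ... | yes (divides c refl) =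
    Product.map (inside ∷_) (λ c≡∏T → trans (*-comm c (p zero)) (cong (p zero *_) c≡∏T))
                (∣∏⇒≡∏ (p-prime ∘ suc) S c∣∏)
    where
    instance _ = prime⇒nonZero (p-prime zero)
    c∣∏ : c ∣ ∏ (p ∘ suc) S
    c∣∏ = *-cancelʳ-∣ (p zero) (subst (c * p zero ∣_) (*-comm (p zero) _) d∣∏)
  ... | no p₀∤d = Product.map (outside ∷_) id (∣∏⇒≡∏ (p-prime ∘ suc) S d∣∏′)
    where
    d∣∏′ : d ∣ ∏ (p ∘ suc) S
    d∣∏′ = coprime-divisor (Coprimality.sym (prime∤⇒coprime (p-prime zero) p₀∤d)) d∣∏
  ∣∏⇒≡∏ p-prime (outside ∷ S) d∣∏ = Product.map (outside ∷_) id (∣∏⇒≡∏ (p-prime ∘ suc) S d∣∏)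

  module _ {k} {p : Fin k → ℕ} (p-prime : ∀ i → Prime (p i)) (p-injective : Injective _≡_ _≡_ p) where

    p∣∏⇒∈ : ∀ S {i} → p i ∣ ∏ p S → i ∈ S
    p∣∏⇒∈ S {i} pᵢ∣∏ with j , j∈S , pᵢ∣pⱼ ← prime∣∏ S (p-prime i) pᵢ∣∏ =
      subst (_∈ S) (sym (p-injective (prime∣prime⇒≡ (p-prime i) (p-prime j) pᵢ∣pⱼ))) j∈S

    ∏-injective : ∀ {S T} → ∏ p S ≡ ∏ p T → S ≡ T
    ∏-injective {S} {T} eq = ⊆-antisym
      (λ i∈S → p∣∏⇒∈ T (subst (_ ∣_) eq (p∣∏ i∈S)))
      (λ i∈T → p∣∏⇒∈ S (subst (_ ∣_) (sym eq) (p∣∏ i∈T)))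

  ∏∣ : ∀ {k} {p : Fin k → ℕ} → (∀ i → Prime (p i)) → Injective _≡_ _≡_ p →
    ∀ S {m} → (∀ i → i ∈ S → p i ∣ m) → ∏ p S ∣ m
  ∏∣ p-prime p-inj []            {m} _ = 1∣ m
  ∏∣ {p = p} p-prime p-inj (inside  ∷ S) pᵢ∣m =
    coprime⇒*∣ (prime∤⇒coprime (p-prime zero) p₀∤∏) (pᵢ∣m zero here)
      (∏∣ (p-prime ∘ suc) (λ eq → suc-injective (p-inj eq)) S (λ i i∈S → pᵢ∣m (suc i) (there i∈S)))
    where
    p₀∤∏ : ¬ p zero ∣ ∏ (p ∘ suc) S
    p₀∤∏ p₀∣∏ with () ← p∣∏⇒∈ p-prime p-inj (outside ∷ S) p₀∣∏
  ∏∣ p-prime p-inj (outside ∷ S) pᵢ∣m =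
    ∏∣ (p-prime ∘ suc) (λ eq → suc-injective (p-inj eq)) S (λ i i∈S → pᵢ∣m (suc i) (there i∈S))

open import Data.Nat using (ℕ; NonZero; _*_)
open import Data.Nat.Primality using (Prime)
open import Data.Nat.Tactic.RingSolver using (solve-∀)
open import Data.Integer as ℤ using (ℤ; 0ℤ; 1ℤ)
open import Data.List.Properties as List using ()
open import Data.Vec as Vec using (Vec; []; _∷_; lookup)
open import Data.Vec.Properties as Vec using ()
open import Data.Bool using (if_then_else_)
open import Data.Bool.Properties as Bool using ()
open import Data.Fin using (Fin; _≟_)
open import Data.Fin.Patterns using (0F; 1F; 2F; 3F)
open import Data.Fin.Properties using (any?; all?)
open import Data.Fin.Subset using (Subset; inside; outside; ⊤; ∁; _∩_; Nonempty; Empty)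
open import Data.Fin.Subset.Properties using (nonempty?; anySubset?)
open import Data.Product using (_×_; _,_)
open import Data.Sum using (inj₁; inj₂)
open import Data.Empty using (⊥-elim)
open import Function using (_∘_)
open import Function.Bundles using (_↔_; _⇔_; Inverse; Equivalence; mk↔ₛ′)
open import Function.Definitions using (Injective)
open import Relation.Nullary using (Dec; yes; no; does)
open import Relation.Nullary.Decidable using (¬?; _→-dec_; from-yes; decidable-stable)
open import Relation.Binary.PropositionalEquality
open Determinant using (Matrix; charPolyAt-cong; charPolyAt-conjugate)
open Polynomial using (eval; charPolyᴾ; eval-charPolyᴾ)
open TargetPolynomial using (targetᴾ; eval-targetᴾ)
open PrimeProducts using (∏)

module Squarefree
  {k} {p : Fin k → ℕ} (p-prime : ∀ i → Prime (p i)) (p-injective : Injective _≡_ _≡_ p)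
  (n : ℕ) {{_ : NonZero n}} (n≡∏ : n ≡ ∏ p ⊤) where

  open import Data.Nat.Divisibility using (_∣_; _∣?_; ∣-refl; ∣-trans; ∣1⇒≡1; ∣m⇒∣m*n; ∣m∣n⇒∣m+n)
  open import Data.Nat.Primality using (euclidsLemma)
  open import Data.Fin using (toℕ)
  open import Data.Fin.Subset using (_∈_; ⁅_⁆)
  open import Data.Fin.Subset.Properties
    using (∈⊤; x∈⁅x⁆; x∈⁅y⁆⇒x≡y; x∈p∩q⁻; x∈p∩q⁺; x∈∁p⇒x∉p; x∉∁p⇒x∈p; x∈p⇒x∉∁p; x∉p⇒x∈∁p)
  open import Data.Product using (∃-syntax; proj₁; proj₂)
  open import Data.Empty using (⊥-elim-irr)
  open import Function.Bundles using (mk⇔)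
  open ℤₙIdeals
  open PrimeProducts

  open Equivalence

  ∏∣n : ∀ S → ∏ p S ∣ n
  ∏∣n S = subst (∏ p S ∣_) (sym n≡∏) (∏∣ p-prime p-injective S (λ i _ → p∣∏ {p = p} (∈⊤ {x = i})))

  p∣n : ∀ i → p i ∣ n
  p∣n i = subst (p i ∣_) (sym n≡∏) (p∣∏ {p = p} (∈⊤ {x = i}))

  all-p∣⇒n∣ : ∀ {m} → (∀ i → p i ∣ m) → n ∣ m
  all-p∣⇒n∣ pᵢ∣m = subst (_∣ _) (sym n≡∏) (∏∣ p-prime p-injective ⊤ (λ i _ → pᵢ∣m i))

  record Represents (I : Ideal n) (S : Subset k) : Set where
    constructor represents
    field ∈⇔∏∣ : ∀ x → x ∈ carrier I ⇔ ∏ p S ∣ toℕ x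
  open Represents

  Represents-unique : ∀ {I S T} → Represents I S → Represents I T → S ≡ T
  Represents-unique {S = S} {T} I~S I~T = ∏-injective p-prime p-injective (sameMultiples⇒≡ (∏∣n S) (∏∣n T)
    (λ x → to (∈⇔∏∣ I~T x) ∘ from (∈⇔∏∣ I~S x))
    (λ x → to (∈⇔∏∣ I~S x) ∘ from (∈⇔∏∣ I~T x)))

  nonempty⇒proper : ∀ {I S} → Represents I S → Nonempty S → ProperIdeal I
  nonempty⇒proper {S = S} I~S (i , i∈S) = [ 1 ]ₙ , λ 1∈I →
    prime≢1 (p-prime i) (∣1⇒≡1 (∣-trans (p∣∏ i∈S) (∣-[]ₙ⁻ (∏∣n S) (to (∈⇔∏∣ I~S _) 1∈I))))

  proper⇒nonempty : ∀ {I S} → Represents I S → ProperIdeal I → Nonempty S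
  proper⇒nonempty {S = S} I~S (x , x∉I) = decidable-stable (nonempty? S) λ S-empty →
    x∉I (from (∈⇔∏∣ I~S x) (∏∣ p-prime p-injective S λ i i∈S → ⊥-elim (S-empty (i , i∈S))))

  co-nonempty⇒nonzero : ∀ {I S} → Represents I S → Nonempty (∁ S) → NonzeroIdeal I
  co-nonempty⇒nonzero {S = S} I~S (i , i∉S) =
    [ ∏ p S ]ₙ , from (∈⇔∏∣ I~S _) (∣-[]ₙ (∏∣n S) ∣-refl) , λ ∏S≡0 →
      x∈∁p⇒x∉p i∉S (p∣∏⇒∈ p-prime p-injective S (∣-trans (p∣n i) ([]ₙ≡0ₙ⇒n∣ ∏S≡0)))

  nonzero⇒co-nonempty : ∀ {I S} → Represents I S → NonzeroIdeal I → Nonempty (∁ S)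
  nonzero⇒co-nonempty {S = S} I~S (x , x∈I , x≢0) = decidable-stable (nonempty? (∁ S)) λ ∁S-empty →
    x≢0 (n∣⇒≡0ₙ (all-p∣⇒n∣ λ i →
      ∣-trans (p∣∏ (x∉∁p⇒x∈p (∁S-empty ∘ (i ,_)))) (to (∈⇔∏∣ I~S x) x∈I)))

  idealOf : Subset k → Ideal n
  idealOf S = multiples (∏ p S) (∏∣n S)

  idealOf-represents : ∀ S → Represents (idealOf S) S
  idealOf-represents S = represents (∈-multiplesOf⇔ (∏ p S))

  vertexOf : (S : Subset k) → Nonempty S → Nonempty (∁ S) → Vertex n
  vertexOf S S≢∅ ∁S≢∅ = mkVertex (idealOf S)
    (co-nonempty⇒nonzero (idealOf-represents S) ∁S≢∅) (nonempty⇒proper (idealOf-represents S) S≢∅)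

  generator≡∏ : ∀ v → ∃[ S ] generator (ideal v) ≡ ∏ p S
  generator≡∏ v = ∣∏⇒≡∏ p-prime ⊤ (subst (generator (ideal v) ∣_) n≡∏ (generator∣n (ideal v)))

  subsetOf : Vertex n → Subset k
  subsetOf v = proj₁ (generator≡∏ v)

  subsetOf-represents : ∀ v → Represents (ideal v) (subsetOf v)
  subsetOf-represents v = represents λ x →
    subst (λ g → x ∈ carrier (ideal v) ⇔ g ∣ toℕ x) (proj₂ (generator≡∏ v)) (∈⇔generator∣ (ideal v) x)

  subsetOf-nonempty : ∀ v → Nonempty (subsetOf v)
  subsetOf-nonempty v@(mkVertex _ _ v-proper) = decidable-stable (nonempty? (subsetOf v)) λ ¬ne →
    ⊥-elim-irr (¬ne (proper⇒nonempty (subsetOf-represents v) v-proper))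

  subsetOf-co-nonempty : ∀ v → Nonempty (∁ (subsetOf v))
  subsetOf-co-nonempty v@(mkVertex _ v-nonzero _) = decidable-stable (nonempty? (∁ (subsetOf v))) λ ¬ne →
    ⊥-elim-irr (¬ne (nonzero⇒co-nonempty (subsetOf-represents v) v-nonzero))

  subsetOf-vertexOf : ∀ S S≢∅ ∁S≢∅ → subsetOf (vertexOf S S≢∅ ∁S≢∅) ≡ S
  subsetOf-vertexOf S S≢∅ ∁S≢∅ =
    Represents-unique (subsetOf-represents (vertexOf S S≢∅ ∁S≢∅)) (idealOf-represents S)

  vertexOf-subsetOf : ∀ v {S} S≢∅ ∁S≢∅ → S ≡ subsetOf v → vertexOf S S≢∅ ∁S≢∅ ≡ v
  vertexOf-subsetOf v _ _ refl = Vertex-≡ λ x → mk⇔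
    (from (∈⇔∏∣ (subsetOf-represents v) x) ∘ to (∈⇔∏∣ (idealOf-represents (subsetOf v)) x))
    (from (∈⇔∏∣ (idealOf-represents (subsetOf v)) x) ∘ to (∈⇔∏∣ (subsetOf-represents v) x))

  idealOf-∣ : ∀ S {x} → x ∈ carrier (idealOf S) → ∏ p S ∣ toℕ x
  idealOf-∣ S = to (∈⇔∏∣ (idealOf-represents S) _)

  ∣-idealOf : ∀ S {x} → ∏ p S ∣ toℕ x → x ∈ carrier (idealOf S)
  ∣-idealOf S = from (∈⇔∏∣ (idealOf-represents S) _)

  multiple∈ : ∀ U m → [ ∏ p U * m ]ₙ ∈ carrier (idealOf U)
  multiple∈ U m = ∣-idealOf U (∣-[]ₙ (∏∣n U) (∣m⇒∣m*n m ∣-refl))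

  minimal-nonzero : ∀ i → NonzeroIdeal (idealOf (∁ ⁅ i ⁆))
  minimal-nonzero i =
    co-nonempty⇒nonzero (idealOf-represents (∁ ⁅ i ⁆)) (i , x∉p⇒x∈∁p (x∈p⇒x∉∁p (x∈⁅x⁆ i)))

  -- idealOf (∁ ⁅ i ⁆) is the minimal ideal (n / pᵢ)ℤₙ: it meets the multiples of pᵢ only in 0.
  sum∩minimal≡0 : ∀ {S T i x} → i ∈ S → i ∈ T →
    x ∈Sum[ idealOf S , idealOf T ] → x ∈ carrier (idealOf (∁ ⁅ i ⁆)) → x ≡ 0ₙ
  sum∩minimal≡0 {S} {T} {i} {x} i∈S i∈T (a , b , a∈ , b∈ , refl) x∈J = n∣⇒≡0ₙ (all-p∣⇒n∣ pⱼ∣x)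
    where
    pⱼ∣x : ∀ j → p j ∣ toℕ x
    pⱼ∣x j with j ≟ i
    ... | yes refl =
      ∣-[]ₙ (p∣n j) (∣m∣n⇒∣m+n (∣-trans (p∣∏ i∈S) (idealOf-∣ S a∈)) (∣-trans (p∣∏ i∈T) (idealOf-∣ T b∈)))
    ... | no j≢i   = ∣-trans (p∣∏ (x∉p⇒x∈∁p (j≢i ∘ x∈⁅y⁆⇒x≡y i))) (idealOf-∣ (∁ ⁅ i ⁆) x∈J)

  essential⇒disjoint : ∀ {S T} → Essential (_∈Sum[ idealOf S , idealOf T ]) → Empty (S ∩ T)
  essential⇒disjoint {S} {T} essential (i , i∈S∩T)
    with x , x∈S+T , x∈J , x≢0 ← essential (idealOf (∁ ⁅ i ⁆)) (minimal-nonzero i)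
    = x≢0 (sum∩minimal≡0 (proj₁ (x∈p∩q⁻ S T i∈S∩T)) (proj₂ (x∈p∩q⁻ S T i∈S∩T)) x∈S+T x∈J)

  disjoint⇒essential : ∀ {S T} → Empty (S ∩ T) → Essential (_∈Sum[ idealOf S , idealOf T ])
  disjoint⇒essential {S} {T} S∩T≡∅ J (y , y∈J , y≢0)
    with n ∣? (∏ p S * toℕ y) | n ∣? (∏ p T * toℕ y)
  ... | no n∤∏S·y | _ =
    [ ∏ p S * toℕ y ]ₙ , ∈⇒∈Sumˡ (idealOf S) (idealOf T) (multiple∈ S (toℕ y)) ,
    ∈ᴵ-* J (∏ p S) (∈⇒∈ᴵ J y∈J) , n∤∏S·y ∘ []ₙ≡0ₙ⇒n∣
  ... | yes _ | no n∤∏T·y =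
    [ ∏ p T * toℕ y ]ₙ , ∈⇒∈Sumʳ (idealOf S) (idealOf T) (multiple∈ T (toℕ y)) ,
    ∈ᴵ-* J (∏ p T) (∈⇒∈ᴵ J y∈J) , n∤∏T·y ∘ []ₙ≡0ₙ⇒n∣
  ... | yes n∣∏S·y | yes n∣∏T·y = ⊥-elim (y≢0 (n∣⇒≡0ₙ (all-p∣⇒n∣ pᵢ∣y)))
    where
    pᵢ∣y : ∀ i → p i ∣ toℕ y
    pᵢ∣y i with euclidsLemma (∏ p S) (toℕ y) (p-prime i) (∣-trans (p∣n i) n∣∏S·y)
             | euclidsLemma (∏ p T) (toℕ y) (p-prime i) (∣-trans (p∣n i) n∣∏T·y)
    ... | inj₂ pᵢ∣y | _ = pᵢ∣y
    ... | _ | inj₂ pᵢ∣y = pᵢ∣y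
    ... | inj₁ pᵢ∣∏S | inj₁ pᵢ∣∏T =
      ⊥-elim (S∩T≡∅ (i , x∈p∩q⁺ (p∣∏⇒∈ p-prime p-injective S pᵢ∣∏S , p∣∏⇒∈ p-prime p-injective T pᵢ∣∏T)))

  vertexOf-injective : ∀ {S T} S≢∅ ∁S≢∅ T≢∅ ∁T≢∅ → vertexOf S S≢∅ ∁S≢∅ ≡ vertexOf T T≢∅ ∁T≢∅ → S ≡ T
  vertexOf-injective {S} {T} S≢∅ ∁S≢∅ T≢∅ ∁T≢∅ v≡w =
    trans (sym (subsetOf-vertexOf S S≢∅ ∁S≢∅)) (trans (cong subsetOf v≡w) (subsetOf-vertexOf T T≢∅ ∁T≢∅))

  EAdj-vertexOf⇔ : ∀ {S T} S≢∅ ∁S≢∅ T≢∅ ∁T≢∅ →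
    EAdj (vertexOf S S≢∅ ∁S≢∅) (vertexOf T T≢∅ ∁T≢∅) ⇔ Empty (S ∩ T)
  EAdj-vertexOf⇔ {S} {T} S≢∅ ∁S≢∅ T≢∅ ∁T≢∅ = mk⇔
    (λ adj → essential⇒disjoint (proj₂ adj))
    (λ S∩T≡∅ → distinct S∩T≡∅ ∘ vertexOf-injective S≢∅ ∁S≢∅ T≢∅ ∁T≢∅ , disjoint⇒essential S∩T≡∅)
    where
    distinct : Empty (S ∩ T) → S ≢ T
    distinct S∩T≡∅ refl = S∩T≡∅ (proj₁ S≢∅ , x∈p∩q⁺ (proj₂ S≢∅ , proj₂ S≢∅))


module _ {n : ℕ} .{{_ : NonZero n}} {k : ℕ} where

  IsAdjMatrix-entry : ∀ {e f : Fin k ↔ Vertex n} {M N} → IsAdjMatrix e M → IsAdjMatrix f N →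
    ∀ {i j a b} → Inverse.to e i ≡ Inverse.to f a → Inverse.to e j ≡ Inverse.to f b → M i j ≡ N a b
  IsAdjMatrix-entry adjM adjN {i} {j} {a} {b} i~a j~b with adjM i j | adjN a b
  ... | inj₁ (_ , Mᵢⱼ≡1) | inj₁ (_ , Nₐᵦ≡1) = trans Mᵢⱼ≡1 (sym Nₐᵦ≡1)
  ... | inj₂ (_ , Mᵢⱼ≡0) | inj₂ (_ , Nₐᵦ≡0) = trans Mᵢⱼ≡0 (sym Nₐᵦ≡0)
  ... | inj₁ (adj , _)   | inj₂ (¬adj , _)  = ⊥-elim (¬adj (subst₂ EAdj i~a j~b adj))
  ... | inj₂ (¬adj , _)  | inj₁ (adj , _)   = ⊥-elim (¬adj (subst₂ EAdj (sym i~a) (sym j~b) adj))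

  charPolyAt-IsAdjMatrix : ∀ (e f : Fin k ↔ Vertex n) {M N} → IsAdjMatrix e M → IsAdjMatrix f N →
    ∀ x → charPolyAt M x ≡ charPolyAt N x
  charPolyAt-IsAdjMatrix e f {M} {N} adjM adjN x =
    trans (charPolyAt-cong (λ i j → IsAdjMatrix-entry {e = e} {f} adjM adjN (e~f i) (e~f j)) x)
          (charPolyAt-conjugate σ σ-injective N x)
    where
    σ : Fin k → Fin k
    σ i = Inverse.from f (Inverse.to e i)
    e~f : ∀ i → Inverse.to e i ≡ Inverse.to f (σ i)
    e~f i = sym (Inverse.strictlyInverseˡ f (Inverse.to e i))
    σ-injective : Injective _≡_ _≡_ σ
    σ-injective {i} {j} σi≡σj = begin
      i                                ≡⟨ Inverse.strictlyInverseʳ e i ⟨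
      Inverse.from e (Inverse.to e i)  ≡⟨ cong (Inverse.from e) eᵢ≡eⱼ ⟩
      Inverse.from e (Inverse.to e j)  ≡⟨ Inverse.strictlyInverseʳ e j ⟩
      j                                ∎
      where
      open ≡-Reasoning
      eᵢ≡eⱼ : Inverse.to e i ≡ Inverse.to e j
      eᵢ≡eⱼ = trans (e~f i) (trans (cong (Inverse.to f) σi≡σj) (sym (e~f j)))

  IsAdjMatrix-indicator : ∀ (e : Fin k ↔ Vertex n) {R : Fin k → Fin k → Set} (R? : ∀ i j → Dec (R i j)) →
    (∀ i j → EAdj (Inverse.to e i) (Inverse.to e j) ⇔ R i j) →
    IsAdjMatrix e (λ i j → if does (R? i j) then 1ℤ else 0ℤ)
  IsAdjMatrix-indicator e R? EAdj⇔R i j with R? i j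
  ... | yes Rᵢⱼ = inj₁ (Equivalence.from (EAdj⇔R i j) Rᵢⱼ , refl)
  ... | no ¬Rᵢⱼ = inj₂ (¬Rᵢⱼ ∘ Equivalence.to (EAdj⇔R i j) , refl)

allSubset? : ∀ {k} {P : Subset k → Set} → (∀ S → Dec (P S)) → Dec (∀ S → P S)
allSubset? P? with anySubset? (¬? ∘ P?)
... | yes (S , ¬PS) = no λ ∀P → ¬PS (∀P S)
... | no ∄¬P        = yes λ S → decidable-stable (P? S) (∄¬P ∘ (S ,_))

-- Laplace expansion works through the first rows first, so putting the sets with few disjoint
-- partners there keeps the symbolic computation of the characteristic polynomial small.
labels : Vec (Subset 4) 14
labels =
  (inside  ∷ inside  ∷ inside  ∷ outside ∷ []) ∷
  (inside  ∷ inside  ∷ outside ∷ inside  ∷ []) ∷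
  (inside  ∷ outside ∷ inside  ∷ inside  ∷ []) ∷
  (outside ∷ inside  ∷ inside  ∷ inside  ∷ []) ∷
  (inside  ∷ inside  ∷ outside ∷ outside ∷ []) ∷
  (inside  ∷ outside ∷ inside  ∷ outside ∷ []) ∷
  (inside  ∷ outside ∷ outside ∷ inside  ∷ []) ∷
  (outside ∷ inside  ∷ inside  ∷ outside ∷ []) ∷
  (outside ∷ inside  ∷ outside ∷ inside  ∷ []) ∷
  (outside ∷ outside ∷ inside  ∷ inside  ∷ []) ∷
  (inside  ∷ outside ∷ outside ∷ outside ∷ []) ∷
  (outside ∷ inside  ∷ outside ∷ outside ∷ []) ∷
  (outside ∷ outside ∷ inside  ∷ outside ∷ []) ∷
  (outside ∷ outside ∷ outside ∷ inside  ∷ []) ∷ []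

label : Fin 14 → Subset 4
label = lookup labels

_≟ˢ_ : ∀ {k} (S T : Subset k) → Dec (S ≡ T)
_≟ˢ_ = Vec.≡-dec Bool._≟_

index : Subset 4 → Fin 14
index S with any? (λ a → label a ≟ˢ S)
... | yes (a , _) = a
... | no _        = 0F  -- only for ⊥ and ⊤

label-nonempty : ∀ a → Nonempty (label a)
label-nonempty = from-yes (all? (nonempty? ∘ label))

label-co-nonempty : ∀ a → Nonempty (∁ (label a))
label-co-nonempty = from-yes (all? (nonempty? ∘ ∁ ∘ label))

index-label : ∀ a → index (label a) ≡ a
index-label = from-yes (all? λ a → index (label a) ≟ a)

label-index : ∀ S → Nonempty S → Nonempty (∁ S) → label (index S) ≡ S
label-index = from-yes (allSubset? λ S → nonempty? S →-dec nonempty? (∁ S) →-dec label (index S) ≟ˢ S)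

disjoint? : ∀ a b → Dec (Empty (label a ∩ label b))
disjoint? a b = ¬? (nonempty? (label a ∩ label b))

disjointness : Matrix 14
disjointness a b = if does (disjoint? a b) then 1ℤ else 0ℤ

charPolyᴾ-disjointness : charPolyᴾ disjointness ≡ targetᴾ
charPolyᴾ-disjointness = from-yes (List.≡-dec ℤ._≟_ (charPolyᴾ disjointness) targetᴾ)

charPolyAt-disjointness : ∀ x → charPolyAt disjointness x ≡ targetPoly x
charPolyAt-disjointness x = begin
  charPolyAt disjointness x
    ≡⟨ eval-charPolyᴾ disjointness x ⟨
  eval (charPolyᴾ disjointness) x
    -- explicit endpoints: inferring them would unfold the determinant without sharing
    ≡⟨ cong (λ f → eval f x) {charPolyᴾ disjointness} {targetᴾ} charPolyᴾ-disjointness ⟩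
  eval targetᴾ x
    ≡⟨ eval-targetᴾ x ⟩
  targetPoly x ∎
  where open ≡-Reasoning

module FourPrimes
  (p₁ p₂ p₃ p₄ : ℕ) (p₁-prime : Prime p₁) (p₂-prime : Prime p₂) (p₃-prime : Prime p₃) (p₄-prime : Prime p₄)
  (p₁≢p₂ : p₁ ≢ p₂) (p₁≢p₃ : p₁ ≢ p₃) (p₁≢p₄ : p₁ ≢ p₄) (p₂≢p₃ : p₂ ≢ p₃) (p₂≢p₄ : p₂ ≢ p₄) (p₃≢p₄ : p₃ ≢ p₄)
  (n : ℕ) {{_ : NonZero n}} (n≡p₁p₂p₃p₄ : n ≡ p₁ * p₂ * p₃ * p₄) where

  p : Fin 4 → ℕ
  p = lookup (p₁ ∷ p₂ ∷ p₃ ∷ p₄ ∷ [])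

  p-prime : ∀ i → Prime (p i)
  p-prime 0F = p₁-prime
  p-prime 1F = p₂-prime
  p-prime 2F = p₃-prime
  p-prime 3F = p₄-prime

  p-injective : Injective _≡_ _≡_ p
  p-injective {0F} {0F} _ = refl
  p-injective {1F} {1F} _ = refl
  p-injective {2F} {2F} _ = refl
  p-injective {3F} {3F} _ = refl
  p-injective {0F} {1F} eq = ⊥-elim (p₁≢p₂ eq)
  p-injective {0F} {2F} eq = ⊥-elim (p₁≢p₃ eq)
  p-injective {0F} {3F} eq = ⊥-elim (p₁≢p₄ eq)
  p-injective {1F} {2F} eq = ⊥-elim (p₂≢p₃ eq)
  p-injective {1F} {3F} eq = ⊥-elim (p₂≢p₄ eq)
  p-injective {2F} {3F} eq = ⊥-elim (p₃≢p₄ eq)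
  p-injective {1F} {0F} eq = ⊥-elim (p₁≢p₂ (sym eq))
  p-injective {2F} {0F} eq = ⊥-elim (p₁≢p₃ (sym eq))
  p-injective {3F} {0F} eq = ⊥-elim (p₁≢p₄ (sym eq))
  p-injective {2F} {1F} eq = ⊥-elim (p₂≢p₃ (sym eq))
  p-injective {3F} {1F} eq = ⊥-elim (p₂≢p₄ (sym eq))
  p-injective {3F} {2F} eq = ⊥-elim (p₃≢p₄ (sym eq))

  n≡∏ : n ≡ ∏ p ⊤
  n≡∏ = trans n≡p₁p₂p₃p₄ (reassociate p₁ p₂ p₃ p₄)
    where
    reassociate : ∀ a b c d → a * b * c * d ≡ a * (b * (c * (d * 1)))
    reassociate = solve-∀

  open Squarefree p-prime p-injective n n≡∏

  vertex : Fin 14 → Vertex n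
  vertex a = vertexOf (label a) (label-nonempty a) (label-co-nonempty a)

  enumeration : Fin 14 ↔ Vertex n
  enumeration = mk↔ₛ′ vertex (index ∘ subsetOf) vertex-index index-vertex
    where
    vertex-index : ∀ v → vertex (index (subsetOf v)) ≡ v
    vertex-index v = vertexOf-subsetOf v (label-nonempty a) (label-co-nonempty a)
      (label-index (subsetOf v) (subsetOf-nonempty v) (subsetOf-co-nonempty v))
      where a = index (subsetOf v)
    index-vertex : ∀ a → index (subsetOf (vertex a)) ≡ a
    index-vertex a =
      trans (cong index (subsetOf-vertexOf (label a) (label-nonempty a) (label-co-nonempty a))) (index-label a)

  EAdj-vertex⇔ : ∀ a b → EAdj (vertex a) (vertex b) ⇔ Empty (label a ∩ label b)
  EAdj-vertex⇔ a b =
    EAdj-vertexOf⇔ (label-nonempty a) (label-co-nonempty a) (label-nonempty b) (label-co-nonempty b)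

  disjointness-IsAdjMatrix : IsAdjMatrix enumeration disjointness
  disjointness-IsAdjMatrix = IsAdjMatrix-indicator enumeration disjoint? EAdj-vertex⇔

mainTheorem10 : (p₁ p₂ p₃ p₄ : ℕ) → Prime p₁ → Prime p₂ → Prime p₃ → Prime p₄ →
    p₁ ≢ p₂ → p₁ ≢ p₃ → p₁ ≢ p₄ → p₂ ≢ p₃ → p₂ ≢ p₄ → p₃ ≢ p₄ →
    (n : ℕ) → {{nz : NonZero n}} → n ≡ p₁ * p₂ * p₃ * p₄ →
    (Fin 14 ↔ Vertex n) ×
    ((e : Fin 14 ↔ Vertex n) → (M : Fin 14 → Fin 14 → ℤ) → IsAdjMatrix e M →
    (x : ℤ) → charPolyAt M x ≡ targetPoly x)
mainTheorem10 p₁ p₂ p₃ p₄ pr₁ pr₂ pr₃ pr₄ d₁₂ d₁₃ d₁₄ d₂₃ d₂₄ d₃₄ n n≡p₁p₂p₃p₄ =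
  enumeration , λ e M M-adj x →
    trans (charPolyAt-IsAdjMatrix e enumeration M-adj disjointness-IsAdjMatrix x) (charPolyAt-disjointness x)
  where open FourPrimes p₁ p₂ p₃ p₄ pr₁ pr₂ pr₃ pr₄ d₁₂ d₁₃ d₁₄ d₂₃ d₂₄ d₃₄ n n≡p₁p₂p₃p₄
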